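{- Let $\mu$ be a weak composition of $n$. The set $\{\bar c(\sigma)\mid\sigma\in\mathfrak{S}_\mu\}$ spans $\widetilde H^{n-2}((\hat0,[n]^\mu))$, and all linear relations among these generators are consequences of the relations $$\bar c(\alpha x^iy^i\beta)+\bar c(\alpha y^ix^i\beta)=0,$$ $$\bar c(\alpha x^iy^j\beta)+\bar c(\alpha y^jx^i\beta)+\bar c(\alpha y^ix^j\beta)+\bar c(\alpha x^jy^i\beta)=0,$$ for colors $i\ne j$ in $\operatorname{supp}(\mu)$ (and $i\in\operatorname{supp}(\mu)$ in the first relation), distinct $x,y\in[n]$ and colored words $\alpha,\beta$ such that the colored permutations involved lie in $\mathfrak{S}_\mu$.
   Context: $\mathbf{k}$ is a field, $\mathbb{P}$ the positive integers. A weak composition is a sequence $\mu=(\mu(1),\mu(2),\dots)$ of nonnegative integers with $|\mu|=\sum\mu(i)<\infty$; $\operatorname{supp}(\mu)=\{j:\mu(j)\neq0\}$; $\mathbf e_r$ has a $1$ in position $r$ and $0$ elsewhere. A colored letter is $x^i=(x,i)\in[n]\times\mathbb{P}$ with color $i$; a colored permutation of $[n]$ is a word of colored letters whose uncolored letters form a permutation of $[n]$; its content counts letters of each color; $\mathfrak{S}_\mu$ is the set of colored permutations with content $\mu$; $\alpha x^iy^j\beta$ denotes the concatenation of colored words. The weighted boolean algebra $\mathbb{B}_n^w$ is the poset of pairs $B^\nu$ with $B\subseteq[n]$, $\nu$ a weak composition with $|\nu|=|B|$, ordered by $A^\nu\le B^\eta$ iff $A\subseteq B$ and $\nu\le\eta$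 componentwise; $\hat0=\varnothing^{\mathbf0}$. For $\sigma\in\mathfrak{S}_\mu$, $c(\sigma)$ is the maximal chain of $[\hat0,[n]^\mu]$ whose rank-$i$ element is $\{\sigma(1),\dots,\sigma(i)\}^{\mathbf e_{c_1}+\cdots+\mathbf e_{c_i}}$ ($c_k$ the color of $\sigma(k)$), and $\bar c(\sigma)=c(\sigma)\setminus\{\hat0,[n]^\mu\}$. Reduced cohomology is that of the order complex over $\mathbf{k}$; the top cohomology of the pure open interval $(\hat0,[n]^\mu)$ is the quotient of the $\mathbf{k}$-span of its maximal chains by the image of the coboundary map, and a maximal chain denotes its class there. -}

module Defs where

open import Level using (Level; _⊔_) renaming (suc to lsuc)
open import Algebra.Bundles using (CommutativeRing)
open import Data.Nat using (ℕ; zero; suc; _≤_; _∸_)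
import Data.Nat as Nat
open import Data.Bool using (Bool; true; false)
open import Data.Fin using (Fin; toℕ)
import Data.Fin.Properties as FinP
open import Data.Fin.Subset using (Subset; ⁅_⁆; _∪_; ∣_∣; _⊆_; ⊥; ⊤)
open import Data.List using (List; []; _∷_; _++_; map; foldr; length; take; upTo; allFin; removeAt; tabulate)
import Data.List.Properties as ListP
open import Data.List.Relation.Unary.All using (All)
open import Data.List.Relation.Unary.Linked using (Linked)
open import Data.List.Relation.Binary.Permutation.Propositional using (_↭_)
open import Data.Vec using (Vec; lookup; replicate)
import Data.Vec as Vec
import Data.Vec.Properties as VecP
open import Data.Vec.Relation.Binary.Pointwise.Inductive using (Pointwise)
import Data.Sum
open import Data.Product using (_×_; _,_; proj₁; proj₂; Σ; ∃)
import Data.Product.Properties as ProdP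
import Data.Bool.Properties as BoolP
open import Relation.Nullary using (¬_; Dec; yes; no)
open import Relation.Binary.Definitions using (DecidableEquality)
open import Relation.Binary.PropositionalEquality using (_≡_; _≢_)

record Field (c ℓ : Level) : Set (lsuc (c ⊔ ℓ)) where
  field
    commutativeRing : CommutativeRing c ℓ
  open CommutativeRing commutativeRing public
  field
    0≉1     : ¬ (0# ≈ 1#)
    inverse : ∀ x → ¬ (x ≈ 0#) → ∃ λ y → x * y ≈ 1#

-- A weak composition μ is represented by a vector
-- μ : Vec ℕ L (any L large enough to contain supp μ); the color
-- c : Fin L stands for the positive integer toℕ c + 1, and μ(r) = 0 for
-- r > L.

∣_∣w : ∀ {L} → Vec ℕ L → ℕ
∣ v ∣w = Vec.foldr _ Nat._+_ 0 v

ColLetter : ℕ → ℕ → Set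
ColLetter n L = Fin n × Fin L

ColWord : ℕ → ℕ → Set
ColWord n L = List (ColLetter n L)

count : ∀ {a} {A : Set a} → (A → Bool) → List A → ℕ
count p []       = 0
count p (x ∷ xs) with p x
... | true  = suc (count p xs)
... | false = count p xs

isColor : ∀ {n L} → Fin L → ColLetter n L → Bool
isColor c (x , i) with i FinP.≟ c
... | yes _ = true
... | no  _ = false

content : ∀ {n L} → ColWord n L → Vec ℕ L
content w = Vec.tabulate (λ c → count (isColor c) w)

IsColPerm : ∀ {n L} → Vec ℕ L → ColWord n L → Set
IsColPerm {n} μ w = (map proj₁ w ↭ allFin n) × (content w ≡ μ)

supp : ∀ {L} → Vec ℕ L → Fin L → Set
supp μ i = lookup μ i ≢ 0

-- The weighted boolean algebra (elements with weight supported in [L],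
-- which contains every element of the interval [0̂, [n]^μ]).

Elem : ℕ → ℕ → Set
Elem n L = Subset n × Vec ℕ L

IsElem : ∀ {n L} → Elem n L → Set
IsElem (B , ν) = ∣ ν ∣w ≡ ∣ B ∣

_≤w_ : ∀ {n L} → Elem n L → Elem n L → Set
(A , ν) ≤w (B , η) = (A ⊆ B) × Pointwise _≤_ ν η

_<w_ : ∀ {n L} → Elem n L → Elem n L → Set
a <w b = (a ≤w b) × (a ≢ b)

0̂ : ∀ {n L} → Elem n L
0̂ = (⊥ , replicate _ 0)

top : ∀ {n L} → Vec ℕ L → Elem n L
top μ = (⊤ , μ)

InOpen : ∀ {n L} → Vec ℕ L → Elem n L → Set
InOpen μ e = IsElem e × (0̂ <w e) × (e <w top μ)

-- chains (= faces of the order complex), listed in increasing order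
Chain : ℕ → ℕ → Set
Chain n L = List (Elem n L)

IsChain : ∀ {n L} → Vec ℕ L → Chain n L → Set
IsChain μ c = All (InOpen μ) c × Linked _<w_ c

-- maximal chains of the (pure, rank n) open interval: n - 1 elements
IsMaxChain : ∀ {n L} → Vec ℕ L → Chain n L → Set
IsMaxChain {n} μ c = IsChain μ c × (suc (length c) ≡ n)

-- chains of dimension n-3 (the domain of the top coboundary map;
-- for n = 2 this is the empty chain, as reduced cohomology requires)
IsSubMaxChain : ∀ {n L} → Vec ℕ L → Chain n L → Set
IsSubMaxChain {n} μ d = IsChain μ d × (suc (suc (length d)) ≡ n)

_≟E_ : ∀ {n L} → DecidableEquality (Elem n L)
_≟E_ = ProdP.≡-dec (VecP.≡-dec BoolP._≟_) (VecP.≡-dec Data.Nat._≟_)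

_≟C_ : ∀ {n L} → DecidableEquality (Chain n L)
_≟C_ = ListP.≡-dec _≟E_

_≟W_ : ∀ {n L} → DecidableEquality (ColWord n L)
_≟W_ = ListP.≡-dec (ProdP.≡-dec FinP._≟_ FinP._≟_)

lettersOf : ∀ {n L} → ColWord n L → Subset n
lettersOf = foldr (λ p s → ⁅ proj₁ p ⁆ ∪ s) ⊥

elemOf : ∀ {n L} → ColWord n L → Elem n L
elemOf w = (lettersOf w , content w)

-- rank-i elements for i = 1, …, n-1
cbar : ∀ {n L} → ColWord n L → Chain n L
cbar {n} σ = map (λ i → elemOf (take (suc i) σ)) (upTo (n ∸ 1))

module Lin {c ℓ : Level} (F : Field c ℓ) where
  open Field F

  Σ-list : ∀ {a} {A : Set a} → (A → Carrier) → List A → Carrier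
  Σ-list f = foldr (λ x s → f x + s) 0#

  ind : ∀ {a} {A : Set a} → DecidableEquality A → A → A → Carrier
  ind eq x y with eq x y
  ... | yes _ = 1#
  ... | no  _ = 0#

  sgn : ℕ → Carrier
  sgn zero    = 1#
  sgn (suc j) = - sgn j

  -- coefficient of the maximal chain cm in the coboundary δ(e_d) of the
  -- basis cochain e_d:  Σ_j (-1)^j [ cm with its j-th element removed = d ]
  cobCoeff : ∀ {n L} → Chain n L → Chain n L → Carrier
  cobCoeff {n} {L} d cm =
    Σ-list (λ j → sgn (toℕ j) * ind _≟C_ (removeAt cm j) d) (allFin (length cm))

  -- the image of the coboundary C^{n-3} → C^{n-2}: a top cochain v
  -- (given by its values on maximal chains) lies in im δ
  InImδ : ∀ {n L} → Vec ℕ L → (Chain n L → Carrier) → Set (c ⊔ ℓ)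
  InImδ {n} {L} μ v =
    ∃ λ (ds : List (Carrier × Chain n L)) →
      All (λ p → IsSubMaxChain μ (proj₂ p)) ds ×
      (∀ cm → IsMaxChain μ cm → v cm ≈ Σ-list (λ p → proj₁ p * cobCoeff (proj₂ p) cm) ds)

  cbarImage : ∀ {n L} → List (Carrier × ColWord n L) → Chain n L → Carrier
  cbarImage as cm = Σ-list (λ p → proj₁ p * ind _≟C_ (cbar (proj₂ p)) cm) as

  Rel₁ : ∀ {n L} → Vec ℕ L → (ColWord n L → Carrier) → Set ℓ
  Rel₁ {n} {L} μ g =
    ∃ λ (α : ColWord n L) → ∃ λ (β : ColWord n L) → ∃ λ (x : Fin n) → ∃ λ (y : Fin n) →
    ∃ λ (i : Fin L) →
      supp μ i × x ≢ y ×
      IsColPerm μ (α ++ (x , i) ∷ (y , i) ∷ β) ×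
      IsColPerm μ (α ++ (y , i) ∷ (x , i) ∷ β) ×
      (∀ w → g w ≈ ind _≟W_ (α ++ (x , i) ∷ (y , i) ∷ β) w
                    + ind _≟W_ (α ++ (y , i) ∷ (x , i) ∷ β) w)

  Rel₂ : ∀ {n L} → Vec ℕ L → (ColWord n L → Carrier) → Set ℓ
  Rel₂ {n} {L} μ g =
    ∃ λ (α : ColWord n L) → ∃ λ (β : ColWord n L) → ∃ λ (x : Fin n) → ∃ λ (y : Fin n) →
    ∃ λ (i : Fin L) → ∃ λ (j : Fin L) →
      supp μ i × supp μ j × i ≢ j × x ≢ y ×
      IsColPerm μ (α ++ (x , i) ∷ (y , j) ∷ β) ×
      IsColPerm μ (α ++ (y , j) ∷ (x , i) ∷ β) ×
      IsColPerm μ (α ++ (y , i) ∷ (x , j) ∷ β) ×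
      IsColPerm μ (α ++ (x , j) ∷ (y , i) ∷ β) ×
      (∀ w → g w ≈ ind _≟W_ (α ++ (x , i) ∷ (y , j) ∷ β) w
                    + ind _≟W_ (α ++ (y , j) ∷ (x , i) ∷ β) w
                    + ind _≟W_ (α ++ (y , i) ∷ (x , j) ∷ β) w
                    + ind _≟W_ (α ++ (x , j) ∷ (y , i) ∷ β) w)

  Rel : ∀ {n L} → Vec ℕ L → (ColWord n L → Carrier) → Set ℓ
  Rel μ g = Rel₁ μ g Data.Sum.⊎ Rel₂ μ g

  InRelSpan : ∀ {n L} → Vec ℕ L → (ColWord n L → Carrier) → Set (c ⊔ ℓ)
  InRelSpan {n} {L} μ v =
    ∃ λ (gs : List (Carrier × (ColWord n L → Carrier))) →
      All (λ p → Rel μ (proj₂ p)) gs ×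
      (∀ w → v w ≈ Σ-list (λ p → proj₁ p * proj₂ p w) gs)

-- Going up one rank in the weighted boolean algebra adjoins a single colored letter x^i to
-- B^ν, so the maximal chains of [0̂, [n]^μ] are exactly the chains c̄(σ), σ ∈ 𝔖_μ, and σ is
-- recovered from c̄(σ).  Top cochains are therefore functions on 𝔖_μ, and im δ is spanned by
-- the coboundaries δ(e_d) of the chains d of length n - 3.  Such a d is c̄(α x^i y^j β) with its
-- element of rank |α| + 1 removed, and the maximal chains through d are the c̄(α u v β) for which
-- u v leads to the same element as x^i y^j: (u , v) is (x^i , y^j) or (y^j , x^i) and, when
-- i ≠ j, also (y^i , x^j) or (x^j , y^i).  All of them miss d at the same position |α|, so δ(e_d)
-- is ±1 times the relation vector of α, x, y, i, j, β, and every relation vector arises this way.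

module Submission where

open import Level using (Level)
open import Data.Bool using (true; false) renaming (_≟_ to _≟ᵇ_)
open import Data.Empty using (⊥-elim)
open import Data.Fin using (Fin; toℕ; fromℕ<; zero; suc)
import Data.Fin.Properties as FinP
open import Data.Fin.Subset using (Subset; ⁅_⁆; _∪_; _⊆_; ∣_∣)
import Data.Fin.Subset as S
import Data.Fin.Subset.Properties as SP
open import Data.List using (List; []; _∷_; _++_; map; length; take; upTo; allFin; applyUpTo; [_])
import Data.List as List
import Data.List.Properties as LP
open import Data.List.Membership.Propositional using (_∈_)
import Data.List.Membership.Propositional.Properties as MP
open import Data.List.Membership.Propositional.Properties.WithK using (unique∧set⇒bag)
open import Data.List.Relation.Binary.BagAndSetEquality using (∼bag⇒↭)
open import Data.List.Relation.Binary.Permutation.Propositional using (_↭_; ↭-sym; ↭⇒↭ₛ)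
import Data.List.Relation.Binary.Permutation.Propositional.Properties as PermP
import Data.List.Relation.Binary.Permutation.Setoid.Properties as SetoidPerm
open import Data.List.Relation.Unary.All as All using (All; []; _∷_)
import Data.List.Relation.Unary.All.Properties as AllP
open import Data.List.Relation.Unary.AllPairs using ([]; _∷_)
open import Data.List.Relation.Unary.Any using (here; there)
open import Data.List.Relation.Unary.Linked as Linked using (Linked; []; [-]; _∷_)
import Data.List.Relation.Unary.Linked.Properties as LinkedP
open import Data.List.Relation.Unary.Unique.Propositional using (Unique)
import Data.List.Relation.Unary.Unique.Propositional.Properties as UniqueP
open import Data.Nat using (ℕ; zero; suc; _≤_; _<_; _+_; _∸_; z≤n; s≤s)
import Data.Nat.Properties as NP
open import Data.Product using (_×_; _,_; proj₁; proj₂; Σ; ∃)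
open import Data.Sum using (_⊎_; inj₁; inj₂)
open import Data.Unit using (⊤; tt)
open import Data.Vec using (Vec; []; _∷_; lookup; replicate; _[_]≔_; _[_]%=_)
open import Data.Vec.Relation.Binary.Pointwise.Inductive as PW using (Pointwise; []; _∷_)
import Data.Vec.Properties as VecP
open import Function.Base using (_∘_; case_of_)
open import Function.Bundles using (mk⇔)
open import Relation.Binary.PropositionalEquality hiding ([_])
open import Relation.Nullary using (¬_; Dec; yes; no)
open import Relation.Nullary.Decidable using (map′; _×-dec_)
open import Relation.Binary.Definitions using (DecidableEquality; tri<; tri≈; tri>)
import Relation.Binary.Reasoning.Setoid

open import Defs

private variable n L : ℕ

lookup⇒≡ : ∀ {A : Set} {m} {u v : Vec A m} → (∀ c → lookup u c ≡ lookup v c) → u ≡ v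
lookup⇒≡ {u = u} {v} h = trans (sym (VecP.tabulate∘lookup u)) (trans (VecP.tabulate-cong h) (VecP.tabulate∘lookup v))

unique∧set⇒↭ : ∀ {A : Set} {xs ys : List A} → Unique xs → Unique ys →
  (∀ {z} → z ∈ xs → z ∈ ys) → (∀ {z} → z ∈ ys → z ∈ xs) → xs ↭ ys
unique∧set⇒↭ ux uy f g = ∼bag⇒↭ (unique∧set⇒bag ux uy (mk⇔ f g))

Unique-resp-↭ : ∀ {A : Set} {xs ys : List A} → xs ↭ ys → Unique xs → Unique ys
Unique-resp-↭ {A} p = SetoidPerm.Unique-resp-↭ (setoid A) (↭⇒↭ₛ p)

removeAtℕ : ∀ {A : Set} → List A → ℕ → List A
removeAtℕ []       k       = []
removeAtℕ (x ∷ xs) zero    = xs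
removeAtℕ (x ∷ xs) (suc k) = x ∷ removeAtℕ xs k

removeAt≡removeAtℕ : ∀ {A : Set} (xs : List A) (j : Fin (length xs)) → List.removeAt xs j ≡ removeAtℕ xs (toℕ j)
removeAt≡removeAtℕ (x ∷ xs) zero    = refl
removeAt≡removeAtℕ (x ∷ xs) (suc j) = cong (x ∷_) (removeAt≡removeAtℕ xs j)

All-removeAtℕ : ∀ {A : Set} {P : A → Set} (xs : List A) (k : ℕ) → All P xs → All P (removeAtℕ xs k)
All-removeAtℕ []       k       ps       = ps
All-removeAtℕ (x ∷ xs) zero    (p ∷ ps) = ps
All-removeAtℕ (x ∷ xs) (suc k) (p ∷ ps) = p ∷ All-removeAtℕ xs k ps

length-removeAtℕ : ∀ {A : Set} (xs : List A) (k : ℕ) → k < length xs → suc (length (removeAtℕ xs k)) ≡ length xs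
length-removeAtℕ (x ∷ xs) zero    _        = refl
length-removeAtℕ (x ∷ xs) (suc k) (s≤s lt) = cong suc (length-removeAtℕ xs k lt)

map-removeAtℕ : ∀ {A B : Set} (f : A → B) (xs : List A) (k : ℕ) → map f (removeAtℕ xs k) ≡ removeAtℕ (map f xs) k
map-removeAtℕ f []       k       = refl
map-removeAtℕ f (x ∷ xs) zero    = refl
map-removeAtℕ f (x ∷ xs) (suc k) = cong (f x ∷_) (map-removeAtℕ f xs k)

module _ {A : Set} {R : A → A → Set} where

  Linked-∷ : ∀ {x ys} → All (R x) ys → Linked R ys → Linked R (x ∷ ys)
  Linked-∷ []      _   = [-]
  Linked-∷ (r ∷ _) rys = r ∷ rys

  Linked-∷ʳ : ∀ xs {z} → Linked R xs → All (λ x → R x z) xs → Linked R (xs ++ [ z ])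
  Linked-∷ʳ []           _           _            = [-]
  Linked-∷ʳ (x ∷ [])     _           (r ∷ [])     = r ∷ [-]
  Linked-∷ʳ (x ∷ y ∷ xs) (rxy ∷ rys) (_ ∷ rs)     = rxy ∷ Linked-∷ʳ (y ∷ xs) rys rs

  module _ (R-trans : ∀ {x y z} → R x y → R y z → R x z) where

    Linked-head : ∀ {x ys} → Linked R (x ∷ ys) → All (R x) ys
    Linked-head [-]         = []
    Linked-head (rxy ∷ rys) = LinkedP.Linked⇒All R-trans rxy rys

    Linked-removeAtℕ : ∀ xs k → Linked R xs → Linked R (removeAtℕ xs k)
    Linked-removeAtℕ []       k       rs = rs
    Linked-removeAtℕ (x ∷ xs) zero    rs = Linked.tail rs
    Linked-removeAtℕ (x ∷ xs) (suc k) rs =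
      Linked-∷ (All-removeAtℕ xs k (Linked-head rs)) (Linked-removeAtℕ xs k (Linked.tail rs))

removeAtℕ-increasing-< : (xs : List ℕ) {j k : ℕ} → Linked _<_ xs → j < k → k < length xs → removeAtℕ xs j ≢ removeAtℕ xs k
removeAtℕ-increasing-< (x ∷ x′ ∷ xs) {zero}  {suc k} (x<x′ ∷ _) _ _ e = NP.<-irrefl (sym (LP.∷-injectiveˡ e)) x<x′
removeAtℕ-increasing-< (x ∷ [])      {zero}  {suc k} _ _ (s≤s ()) _
removeAtℕ-increasing-< (x ∷ xs)      {suc j} {suc k} xs< (s≤s j<k) (s≤s k<) e =
  removeAtℕ-increasing-< xs (Linked.tail xs<) j<k k< (LP.∷-injectiveʳ e)

removeAtℕ-increasing-≢ : (xs : List ℕ) {j k : ℕ} → Linked _<_ xs → j ≢ k → j < length xs → k < length xs →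
  removeAtℕ xs j ≢ removeAtℕ xs k
removeAtℕ-increasing-≢ xs {j} {k} xs< j≢k j< k< with NP.<-cmp j k
... | tri< j<k _ _ = removeAtℕ-increasing-< xs xs< j<k k<
... | tri≈ _ j≡k _ = ⊥-elim (j≢k j≡k)
... | tri> _ _ k<j = removeAtℕ-increasing-< xs xs< k<j j< ∘ sym

-- Adjoining colored letters to elements of the weighted boolean algebra

adjoin : ColLetter n L → Elem n L → Elem n L
adjoin (x , i) (B , ν) = B [ x ]≔ true , ν [ i ]%= suc

adjoinWord : ColWord n L → Elem n L → Elem n L
adjoinWord []      E = E
adjoinWord (a ∷ u) E = adjoinWord u (adjoin a E)

innerChain : ColWord n L → Elem n L → Chain n L
innerChain []          E = []
innerChain (a ∷ [])    E = []
innerChain (a ∷ b ∷ u) E = adjoin a E ∷ innerChain (b ∷ u) (adjoin a E)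

NotIn : Elem n L → ColLetter n L → Set
NotIn (B , _) (x , _) = lookup B x ≡ false

Fresh : ColWord n L → Elem n L → Set
Fresh []      E = ⊤
Fresh (a ∷ u) E = NotIn E a × Fresh u (adjoin a E)

rank : Elem n L → ℕ
rank (B , _) = ∣ B ∣

⁅x⁆∪p≡p[x]≔true : (x : Fin n) (p : Subset n) → ⁅ x ⁆ ∪ p ≡ p [ x ]≔ true
⁅x⁆∪p≡p[x]≔true zero    (b ∷ p) = cong (true ∷_) (SP.∪-identityˡ p)
⁅x⁆∪p≡p[x]≔true (suc x) (b ∷ p) = cong (b ∷_) (⁅x⁆∪p≡p[x]≔true x p)

content-∷ : (a : ColLetter n L) (w : ColWord n L) → content (a ∷ w) ≡ content w [ proj₂ a ]%= suc
content-∷ (x , i) w = lookup⇒≡ λ c → trans (VecP.lookup∘tabulate _ c) (count-∷ c)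
  where
  count-∷ : ∀ c → count (isColor c) ((x , i) ∷ w) ≡ lookup (content w [ i ]%= suc) c
  count-∷ c with i FinP.≟ c
  ... | yes refl = sym (trans (VecP.lookup∘updateAt i (content w)) (cong suc (VecP.lookup∘tabulate _ i)))
  ... | no i≢c   = sym (trans (VecP.lookup∘updateAt′ c i (i≢c ∘ sym) (content w)) (VecP.lookup∘tabulate _ c))

elemOf-∷ : (a : ColLetter n L) (w : ColWord n L) → elemOf (a ∷ w) ≡ adjoin a (elemOf w)
elemOf-∷ (x , i) w = cong₂ _,_ (⁅x⁆∪p≡p[x]≔true x (lettersOf w)) (content-∷ (x , i) w)

[]≔-commutes′ : ∀ {A : Set} {m} (xs : Vec A m) (i j : Fin m) (a : A) →
  xs [ i ]≔ a [ j ]≔ a ≡ xs [ j ]≔ a [ i ]≔ a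
[]≔-commutes′ xs i j a with i FinP.≟ j
... | yes refl = refl
... | no i≢j   = VecP.[]≔-commutes xs i j i≢j

updateAt-commutes′ : ∀ {A : Set} {m} (xs : Vec A m) (i j : Fin m) (f : A → A) →
  xs [ i ]%= f [ j ]%= f ≡ xs [ j ]%= f [ i ]%= f
updateAt-commutes′ xs i j f with i FinP.≟ j
... | yes refl = refl
... | no i≢j   = sym (VecP.updateAt-commutes i j i≢j xs)

adjoin-comm : (a b : ColLetter n L) (E : Elem n L) → adjoin a (adjoin b E) ≡ adjoin b (adjoin a E)
adjoin-comm (x , i) (y , j) (B , ν) = cong₂ _,_ ([]≔-commutes′ B y x true) (updateAt-commutes′ ν j i suc)

adjoinWord-adjoin : (u : ColWord n L) (a : ColLetter n L) (E : Elem n L) →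
  adjoinWord u (adjoin a E) ≡ adjoin a (adjoinWord u E)
adjoinWord-adjoin []      a E = refl
adjoinWord-adjoin (b ∷ u) a E = trans (cong (adjoinWord u) (adjoin-comm b a E)) (adjoinWord-adjoin u a (adjoin b E))

elemOf≡adjoinWord : (w : ColWord n L) → elemOf w ≡ adjoinWord w 0̂
elemOf≡adjoinWord {n} {L} [] =
  cong (S.⊥ ,_) (lookup⇒≡ λ c → trans (VecP.lookup∘tabulate _ c) (sym (VecP.lookup-replicate {n = L} c 0)))
elemOf≡adjoinWord (a ∷ w) = begin
  elemOf (a ∷ w)           ≡⟨ elemOf-∷ a w ⟩
  adjoin a (elemOf w)      ≡⟨ cong (adjoin a) (elemOf≡adjoinWord w) ⟩
  adjoin a (adjoinWord w 0̂) ≡⟨ adjoinWord-adjoin w a 0̂ ⟨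
  adjoinWord (a ∷ w) 0̂     ∎
  where open ≡-Reasoning

applyUpTo≡innerChain : (σ : ColWord n L) (E : Elem n L) →
  applyUpTo (λ i → adjoinWord (take (suc i) σ) E) (length σ ∸ 1) ≡ innerChain σ E
applyUpTo≡innerChain []          E = refl
applyUpTo≡innerChain (a ∷ [])    E = refl
applyUpTo≡innerChain (a ∷ b ∷ u) E = cong (adjoin a E ∷_) (applyUpTo≡innerChain (b ∷ u) (adjoin a E))

cbar≡innerChain : (σ : ColWord n L) → length σ ≡ n → cbar σ ≡ innerChain σ 0̂
cbar≡innerChain {n} σ |σ|≡n = begin
  cbar σ                            ≡⟨ LP.map-cong (λ i → elemOf≡adjoinWord (take (suc i) σ)) (upTo (n ∸ 1)) ⟩
  map prefix (upTo (n ∸ 1))         ≡⟨ LP.map-applyUpTo (λ i → i) prefix (n ∸ 1) ⟩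
  applyUpTo prefix (n ∸ 1)          ≡⟨ cong (λ m → applyUpTo prefix (m ∸ 1)) (sym |σ|≡n) ⟩
  applyUpTo prefix (length σ ∸ 1)   ≡⟨ applyUpTo≡innerChain σ 0̂ ⟩
  innerChain σ 0̂                    ∎
  where
  open ≡-Reasoning
  prefix = λ i → adjoinWord (take (suc i) σ) 0̂

lookup-set-≡ : (B : Subset n) (x : Fin n) → lookup (B [ x ]≔ true) x ≡ true
lookup-set-≡ B x = VecP.lookup∘update x B true

lookup-set-≢ : (B : Subset n) {x y : Fin n} → x ≢ y → lookup (B [ x ]≔ true) y ≡ lookup B y
lookup-set-≢ B x≢y = VecP.lookup∘update′ (x≢y ∘ sym) B true

lookup-set⁺ : (B : Subset n) (x : Fin n) {y : Fin n} → lookup B y ≡ true → lookup (B [ x ]≔ true) y ≡ true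
lookup-set⁺ B x {y} y∈B with x FinP.≟ y
... | yes refl = lookup-set-≡ B x
... | no x≢y   = trans (lookup-set-≢ B x≢y) y∈B

lookup-set⁻ : (B : Subset n) (x : Fin n) {y : Fin n} → lookup (B [ x ]≔ true) y ≡ true → x ≡ y ⊎ lookup B y ≡ true
lookup-set⁻ B x {y} y∈B′ with x FinP.≟ y
... | yes x≡y = inj₁ x≡y
... | no x≢y  = inj₂ (trans (sym (lookup-set-≢ B x≢y)) y∈B′)

lookup-set-false : (B : Subset n) (x : Fin n) {y : Fin n} → lookup (B [ x ]≔ true) y ≡ false →
  x ≢ y × lookup B y ≡ false
lookup-set-false B x {y} y∉B′ = x≢y , y∉B
  where
  x≢y : x ≢ y
  x≢y refl with () ← trans (sym (lookup-set-≡ B x)) y∉B′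
  y∉B : lookup B y ≡ false
  y∉B with lookup B y in eq
  ... | false = refl
  ... | true with () ← trans (sym (lookup-set⁺ B x eq)) y∉B′

fresh⇒unique : (u : ColWord n L) (E : Elem n L) → Fresh u E → Unique (map proj₁ u) × All (NotIn E) u
fresh⇒unique []            E       _         = [] , []
fresh⇒unique ((x , i) ∷ u) (B , ν) (x∉B , f) =
  AllP.map⁺ (All.map (proj₁ ∘ lookup-set-false B x) ∉B′) ∷ uniq ,
  x∉B ∷ All.map (proj₂ ∘ lookup-set-false B x) ∉B′
  where
  uniq = proj₁ (fresh⇒unique u _ f)
  ∉B′  = proj₂ (fresh⇒unique u _ f)

unique⇒fresh : (u : ColWord n L) (E : Elem n L) → Unique (map proj₁ u) → All (NotIn E) u → Fresh u E
unique⇒fresh []            E       _              _            = tt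
unique⇒fresh ((x , i) ∷ u) (B , ν) (x∉u ∷ uniq) (x∉B ∷ u∉B) =
  x∉B , unique⇒fresh u _ uniq (All.zipWith (λ (x≢y , y∉B) → trans (lookup-set-≢ B x≢y) y∉B) (AllP.map⁻ x∉u , u∉B))

lettersOf-∷ : (a : ColLetter n L) (u : ColWord n L) → lettersOf (a ∷ u) ≡ lettersOf u [ proj₁ a ]≔ true
lettersOf-∷ (x , i) u = ⁅x⁆∪p≡p[x]≔true x (lettersOf u)

∈-lettersOf⁻ : (u : ColWord n L) {y : Fin n} → lookup (lettersOf u) y ≡ true → y ∈ map proj₁ u
∈-lettersOf⁻ {n} [] {y} y∈⊥ with () ← trans (sym y∈⊥) (VecP.lookup-replicate {n = n} y false)
∈-lettersOf⁻ (a ∷ u) y∈ rewrite lettersOf-∷ a u with lookup-set⁻ (lettersOf u) (proj₁ a) y∈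
... | inj₁ refl = here refl
... | inj₂ y∈u  = there (∈-lettersOf⁻ u y∈u)

∈-lettersOf⁺ : (u : ColWord n L) {y : Fin n} → y ∈ map proj₁ u → lookup (lettersOf u) y ≡ true
∈-lettersOf⁺ (a ∷ u) (here refl) rewrite lettersOf-∷ a u = lookup-set-≡ (lettersOf u) (proj₁ a)
∈-lettersOf⁺ (a ∷ u) (there y∈) rewrite lettersOf-∷ a u = lookup-set⁺ (lettersOf u) (proj₁ a) (∈-lettersOf⁺ u y∈)

record ColPermWord (μ : Vec ℕ L) (τ : ColWord n L) : Set where
  field
    fresh   : Fresh τ 0̂
    length≡ : length τ ≡ n
    reaches : adjoinWord τ 0̂ ≡ top μ
open ColPermWord public

isColPerm⇒colPermWord : (μ : Vec ℕ L) (τ : ColWord n L) → IsColPerm μ τ → ColPermWord μ τ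
isColPerm⇒colPermWord {n = n} μ τ (perm , content≡μ) = record
  { fresh   = unique⇒fresh τ 0̂ (Unique-resp-↭ (↭-sym perm) (UniqueP.allFin⁺ n))
                (All.universal (λ (x , _) → VecP.lookup-replicate {n = n} x false) τ)
  ; length≡ = trans (sym (LP.length-map proj₁ τ)) (trans (PermP.↭-length perm) (LP.length-tabulate {n = n} (λ i → i)))
  ; reaches = trans (sym (elemOf≡adjoinWord τ)) (cong₂ _,_ letters≡⊤ content≡μ)
  }
  where
  letters≡⊤ : lettersOf τ ≡ S.⊤
  letters≡⊤ = lookup⇒≡ λ y → trans (∈-lettersOf⁺ τ (PermP.∈-resp-↭ (↭-sym perm) (MP.∈-allFin y)))
                                   (sym (VecP.lookup-replicate {n = n} y true))

reachesTop⇒isColPerm : (μ : Vec ℕ L) (τ : ColWord n L) → Fresh τ 0̂ → adjoinWord τ 0̂ ≡ top μ → IsColPerm μ τ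
reachesTop⇒isColPerm {n = n} μ τ fresh reaches = perm , cong proj₂ elemOf≡top
  where
  elemOf≡top : elemOf τ ≡ top μ
  elemOf≡top = trans (elemOf≡adjoinWord τ) reaches
  perm : map proj₁ τ ↭ allFin n
  perm = unique∧set⇒↭ (proj₁ (fresh⇒unique τ 0̂ fresh)) (UniqueP.allFin⁺ n)
           (λ {z} _ → MP.∈-allFin z)
           (λ {z} _ → ∈-lettersOf⁻ τ (trans (cong (λ (B , _) → lookup B z) elemOf≡top) (VecP.lookup-replicate {n = n} z true)))

colPermWord⇒isColPerm : (μ : Vec ℕ L) {τ : ColWord n L} → ColPermWord μ τ → IsColPerm μ τ
colPermWord⇒isColPerm μ τ̂ = reachesTop⇒isColPerm μ _ (fresh τ̂) (reaches τ̂)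

fresh? : (u : ColWord n L) (E : Elem n L) → Dec (Fresh u E)
fresh? []      E = yes tt
fresh? (a ∷ u) E = (lookup (proj₁ E) (proj₁ a) ≟ᵇ false) ×-dec fresh? u (adjoin a E)

isColPerm? : (μ : Vec ℕ L) (w : ColWord n L) → Dec (IsColPerm μ w)
isColPerm? μ w = map′ (λ (f , r) → reachesTop⇒isColPerm μ w f r)
                      (λ cp → let ŵ = isColPerm⇒colPermWord μ w cp in fresh ŵ , reaches ŵ)
                      (fresh? w 0̂ ×-dec (adjoinWord w 0̂ ≟E top μ))

⊆∧∣∣≡⇒≡ : (A B : Subset n) → A ⊆ B → ∣ A ∣ ≡ ∣ B ∣ → A ≡ B
⊆∧∣∣≡⇒≡ []          []          _   _ = refl
⊆∧∣∣≡⇒≡ (false ∷ A) (false ∷ B) A⊆B e = cong (false ∷_) (⊆∧∣∣≡⇒≡ A B (SP.drop-∷-⊆ A⊆B) e)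
⊆∧∣∣≡⇒≡ (false ∷ A) (true ∷ B)  A⊆B e = ⊥-elim (NP.<-irrefl e (s≤s (SP.p⊆q⇒∣p∣≤∣q∣ (SP.drop-∷-⊆ A⊆B))))
⊆∧∣∣≡⇒≡ (true ∷ A)  (false ∷ B) A⊆B e with () ← A⊆B Data.Vec.here
⊆∧∣∣≡⇒≡ (true ∷ A)  (true ∷ B)  A⊆B e = cong (true ∷_) (⊆∧∣∣≡⇒≡ A B (SP.drop-∷-⊆ A⊆B) (NP.suc-injective e))

⊆∧∣∣<⇒∃ : (A B : Subset n) → A ⊆ B → ∣ A ∣ < ∣ B ∣ → ∃ λ x → lookup A x ≡ false × A [ x ]≔ true ⊆ B
⊆∧∣∣<⇒∃ (false ∷ A) (true ∷ B)  A⊆B _ = zero , refl , SP.in⊆in (SP.drop-∷-⊆ A⊆B)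
⊆∧∣∣<⇒∃ (false ∷ A) (false ∷ B) A⊆B lt =
  let x , x∉A , A′⊆B = ⊆∧∣∣<⇒∃ A B (SP.drop-∷-⊆ A⊆B) lt in suc x , x∉A , SP.s⊆s A′⊆B
⊆∧∣∣<⇒∃ (true ∷ A)  (false ∷ B) A⊆B _ with () ← A⊆B Data.Vec.here
⊆∧∣∣<⇒∃ (true ∷ A)  (true ∷ B)  A⊆B (s≤s lt) =
  let x , x∉A , A′⊆B = ⊆∧∣∣<⇒∃ A B (SP.drop-∷-⊆ A⊆B) lt in suc x , x∉A , SP.s⊆s A′⊆B

∣p[x]≔true∣ : (x : Fin n) (p : Subset n) → lookup p x ≡ false → ∣ p [ x ]≔ true ∣ ≡ suc ∣ p ∣
∣p[x]≔true∣ zero    (false ∷ p) _   = refl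
∣p[x]≔true∣ (suc x) (false ∷ p) x∉p = ∣p[x]≔true∣ x p x∉p
∣p[x]≔true∣ (suc x) (true ∷ p)  x∉p = cong suc (∣p[x]≔true∣ x p x∉p)

p⊆p[x]≔true : (x : Fin n) (p : Subset n) → p ⊆ p [ x ]≔ true
p⊆p[x]≔true x p {y} y∈p = VecP.lookup⇒[]= y _ (lookup-set⁺ p x (VecP.[]=⇒lookup y∈p))

infix 4 _≤ᵥ_
_≤ᵥ_ : ∀ {m} → Vec ℕ m → Vec ℕ m → Set
_≤ᵥ_ = Pointwise _≤_

∣∣w-mono-≤ : ∀ {m} {ν η : Vec ℕ m} → ν ≤ᵥ η → ∣ ν ∣w ≤ ∣ η ∣w
∣∣w-mono-≤ []          = z≤n
∣∣w-mono-≤ (a≤b ∷ ν≤η) = NP.+-mono-≤ a≤b (∣∣w-mono-≤ ν≤η)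

≤ᵥ∧∣∣w≡⇒≡ : ∀ {m} {ν η : Vec ℕ m} → ν ≤ᵥ η → ∣ ν ∣w ≡ ∣ η ∣w → ν ≡ η
≤ᵥ∧∣∣w≡⇒≡ []                                    _ = refl
≤ᵥ∧∣∣w≡⇒≡ {ν = a ∷ ν} {b ∷ η} (a≤b ∷ ν≤η) e =
  cong₂ _∷_ a≡b (≤ᵥ∧∣∣w≡⇒≡ ν≤η (NP.+-cancelˡ-≡ a _ _ (trans e (cong (_+ ∣ η ∣w) (sym a≡b)))))
  where
  a≡b : a ≡ b
  a≡b = NP.≤-antisym a≤b (NP.+-cancelʳ-≤ ∣ η ∣w b a (subst (_≤ a + ∣ η ∣w) e (NP.+-monoʳ-≤ a (∣∣w-mono-≤ ν≤η))))

≤ᵥ-antisym : ∀ {m} {ν η : Vec ℕ m} → ν ≤ᵥ η → η ≤ᵥ ν → ν ≡ η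
≤ᵥ-antisym ν≤η η≤ν = ≤ᵥ∧∣∣w≡⇒≡ ν≤η (NP.≤-antisym (∣∣w-mono-≤ ν≤η) (∣∣w-mono-≤ η≤ν))

≤ᵥ∧∣∣w<⇒∃ : ∀ {m} {ν η : Vec ℕ m} → ν ≤ᵥ η → ∣ ν ∣w < ∣ η ∣w → ∃ λ i → ν [ i ]%= suc ≤ᵥ η
≤ᵥ∧∣∣w<⇒∃ {ν = a ∷ ν} {b ∷ η} (a≤b ∷ ν≤η) lt with a NP.<? b
... | yes a<b = zero , a<b ∷ ν≤η
... | no  a≮b with refl ← NP.≤-antisym a≤b (NP.≮⇒≥ a≮b) =
  let i , ν′≤η = ≤ᵥ∧∣∣w<⇒∃ ν≤η (NP.+-cancelˡ-< a _ _ lt) in suc i , a≤b ∷ ν′≤η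

∣ν[i]%=suc∣w : ∀ {m} (i : Fin m) (ν : Vec ℕ m) → ∣ ν [ i ]%= suc ∣w ≡ suc ∣ ν ∣w
∣ν[i]%=suc∣w zero    (a ∷ ν) = refl
∣ν[i]%=suc∣w (suc i) (a ∷ ν) = trans (cong (a +_) (∣ν[i]%=suc∣w i ν)) (NP.+-suc a _)

ν≤ᵥν[i]%=suc : ∀ {m} (i : Fin m) (ν : Vec ℕ m) → ν ≤ᵥ ν [ i ]%= suc
ν≤ᵥν[i]%=suc zero    (a ∷ ν) = NP.n≤1+n a ∷ PW.refl NP.≤-refl
ν≤ᵥν[i]%=suc (suc i) (a ∷ ν) = NP.≤-refl ∷ ν≤ᵥν[i]%=suc i ν

≤w-refl : {E : Elem n L} → E ≤w E
≤w-refl = SP.⊆-refl , PW.refl NP.≤-refl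

≤w-trans : {D E F : Elem n L} → D ≤w E → E ≤w F → D ≤w F
≤w-trans (A⊆B , ν≤η) (B⊆C , η≤ρ) = SP.⊆-trans A⊆B B⊆C , PW.trans NP.≤-trans ν≤η η≤ρ

≤w-antisym : {D E : Elem n L} → D ≤w E → E ≤w D → D ≡ E
≤w-antisym (A⊆B , ν≤η) (B⊆A , η≤ν) = cong₂ _,_ (SP.⊆-antisym A⊆B B⊆A) (≤ᵥ-antisym ν≤η η≤ν)

<w-trans : {D E F : Elem n L} → D <w E → E <w F → D <w F
<w-trans (D≤E , D≢E) (E≤F , _) = ≤w-trans D≤E E≤F , λ { refl → D≢E (≤w-antisym D≤E E≤F) }

0̂-minimum : (E : Elem n L) → 0̂ ≤w E
0̂-minimum (B , ν) = (λ x∈⊥ → ⊥-elim (SP.∉⊥ x∈⊥)) , lowest ν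
  where
  lowest : ∀ {m} (ν : Vec ℕ m) → replicate m 0 ≤ᵥ ν
  lowest []      = []
  lowest (_ ∷ ν) = z≤n ∷ lowest ν

≤w-adjoin : (a : ColLetter n L) (E : Elem n L) → E ≤w adjoin a E
≤w-adjoin (x , i) (B , ν) = p⊆p[x]≔true x B , ν≤ᵥν[i]%=suc i ν

≤w-adjoinWord : (u : ColWord n L) (E : Elem n L) → E ≤w adjoinWord u E
≤w-adjoinWord []      E = ≤w-refl
≤w-adjoinWord (a ∷ u) E = ≤w-trans (≤w-adjoin a E) (≤w-adjoinWord u (adjoin a E))

<w-adjoin : (a : ColLetter n L) (E : Elem n L) → NotIn E a → E <w adjoin a E
<w-adjoin (x , i) (B , ν) x∉B = ≤w-adjoin (x , i) (B , ν) ,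
  λ E≡ → case trans (sym (lookup-set-≡ B x)) (trans (cong (λ E → lookup (proj₁ E) x) (sym E≡)) x∉B) of λ ()

isElem-adjoin : (a : ColLetter n L) (E : Elem n L) → NotIn E a → IsElem E → IsElem (adjoin a E)
isElem-adjoin (x , i) (B , ν) x∉B e = trans (∣ν[i]%=suc∣w i ν) (trans (cong suc e) (sym (∣p[x]≔true∣ x B x∉B)))

rank-adjoin : (a : ColLetter n L) (E : Elem n L) → NotIn E a → rank (adjoin a E) ≡ suc (rank E)
rank-adjoin (x , i) (B , ν) = ∣p[x]≔true∣ x B

rank-mono-< : {D E : Elem n L} → IsElem D → IsElem E → D <w E → rank D < rank E
rank-mono-< {D = A , ν} {B , η} eD eE ((A⊆B , ν≤η) , D≢E) = NP.≤∧≢⇒< (SP.p⊆q⇒∣p∣≤∣q∣ A⊆B) λ e →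
  D≢E (cong₂ _,_ (⊆∧∣∣≡⇒≡ A B A⊆B e) (≤ᵥ∧∣∣w≡⇒≡ ν≤η (trans eD (trans e (sym eE)))))

adjoin-below : {D E : Elem n L} → IsElem D → IsElem E → D ≤w E → rank D < rank E →
  ∃ λ a → NotIn D a × adjoin a D ≤w E
adjoin-below {D = A , ν} {B , η} eD eE (A⊆B , ν≤η) lt =
  let x , x∉A , A′⊆B = ⊆∧∣∣<⇒∃ A B A⊆B lt
      i , ν′≤η       = ≤ᵥ∧∣∣w<⇒∃ ν≤η (subst₂ _<_ (sym eD) (sym eE) lt)
  in (x , i) , x∉A , A′⊆B , ν′≤η

cover⇒adjoin : {D E : Elem n L} → IsElem D → IsElem E → D ≤w E → rank E ≡ suc (rank D) →
  ∃ λ a → NotIn D a × adjoin a D ≡ E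
cover⇒adjoin {D = D} {E} eD eE D≤E rank≡ with adjoin-below eD eE D≤E (NP.≤-reflexive (sym rank≡))
... | a , a∉D , D′⊆E , D′≤E =
  a , a∉D , cong₂ _,_ (⊆∧∣∣≡⇒≡ _ _ D′⊆E rank′≡) (≤ᵥ∧∣∣w≡⇒≡ D′≤E (trans (isElem-adjoin a D a∉D eD) (trans rank′≡ (sym eE))))
  where
  rank′≡ : rank (adjoin a D) ≡ rank E
  rank′≡ = trans (rank-adjoin a D a∉D) (sym rank≡)

-- Chains of the weighted boolean algebra as words

Between : Elem n L → Elem n L → Elem n L → Set
Between D E e = IsElem e × D <w e × e <w E

adjoinWord-above : (a : ColLetter n L) (u : ColWord n L) (E : Elem n L) → Fresh (a ∷ u) E → E <w adjoinWord (a ∷ u) E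
adjoinWord-above a []      E (a∉E , _) = <w-adjoin a E a∉E
adjoinWord-above a (b ∷ u) E (a∉E , f) = <w-trans (<w-adjoin a E a∉E) (adjoinWord-above b u (adjoin a E) f)

innerChain-between : (u : ColWord n L) (E : Elem n L) → Fresh u E → IsElem E →
  All (Between E (adjoinWord u E)) (innerChain u E) × Linked _<w_ (innerChain u E)
innerChain-between []          E _         _  = [] , []
innerChain-between (a ∷ [])    E _         _  = [] , []
innerChain-between (a ∷ b ∷ u) E (a∉E , f) eE
  with innerChain-between (b ∷ u) (adjoin a E) f (isElem-adjoin a E a∉E eE)
... | between , linked =
  (isElem-adjoin a E a∉E eE , E<E′ , adjoinWord-above b u (adjoin a E) f) ∷
    All.map (λ (e , E′<e , e<T) → e , <w-trans E<E′ E′<e , e<T) between ,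
  Linked-∷ (All.map (proj₁ ∘ proj₂) between) linked
  where E<E′ = <w-adjoin a E a∉E

length-innerChain : (a : ColLetter n L) (u : ColWord n L) (E : Elem n L) → length (innerChain (a ∷ u) E) ≡ length u
length-innerChain a []      E = refl
length-innerChain a (b ∷ u) E = cong suc (length-innerChain b u (adjoin a E))

isElem-0̂ : IsElem (0̂ {n} {L})
isElem-0̂ {n} {L} = trans (∣0∣ L) (sym (SP.∣⊥∣≡0 n))
  where
  ∣0∣ : ∀ m → ∣ replicate m 0 ∣w ≡ 0
  ∣0∣ zero    = refl
  ∣0∣ (suc m) = ∣0∣ m

cbar-isMaxChain : (μ : Vec ℕ L) (τ : ColWord n L) → 1 ≤ n → ColPermWord μ τ → IsMaxChain μ (cbar τ)
cbar-isMaxChain μ []      n≥1 τ̂ with () ← NP.<-irrefl (length≡ τ̂) n≥1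
cbar-isMaxChain {L} {n} μ (a ∷ u) n≥1 τ̂ rewrite cbar≡innerChain (a ∷ u) (length≡ τ̂) =
  (All.map inOpen (proj₁ props) , proj₂ props) , trans (cong suc (length-innerChain a u 0̂)) (length≡ τ̂)
  where
  props = innerChain-between (a ∷ u) 0̂ (fresh τ̂) (isElem-0̂ {n} {L})
  inOpen : ∀ {e} → Between 0̂ (adjoinWord (a ∷ u) 0̂) e → InOpen μ e
  inOpen (e , 0̂<e , e<T) = e , 0̂<e , subst (_ <w_) (reaches τ̂) e<T

rank-between : (e T : Elem n L) (es : Chain n L) → IsElem e → IsElem T → All IsElem es →
  Linked _<w_ (e ∷ es ++ [ T ]) → rank e + suc (length es) ≤ rank T
rank-between e T []       ee eT _          (e<T ∷ [-]) = subst (_≤ rank T) (NP.+-comm 1 (rank e)) (rank-mono-< ee eT e<T)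
rank-between e T (f ∷ es) ee eT (ef ∷ ees) (e<f ∷ f<) = begin
  rank e + suc (suc (length es)) ≡⟨ NP.+-suc (rank e) (suc (length es)) ⟩
  suc (rank e) + suc (length es) ≤⟨ NP.+-monoˡ-≤ (suc (length es)) (rank-mono-< ee ef e<f) ⟩
  rank f + suc (length es)       ≤⟨ rank-between f T es ef eT ees f< ⟩
  rank T                         ∎
  where open NP.≤-Reasoning

squeeze : ∀ {a b} k → a < b → b + k ≤ a + suc k → b ≡ suc a
squeeze {a} {b} k a<b ub = NP.≤-antisym (NP.+-cancelʳ-≤ k b (suc a) (subst (b + k ≤_) (NP.+-suc a k) ub)) a<b

innerChain-∷ : (a b : ColLetter n L) (α w : ColWord n L) (E : Elem n L) →
  innerChain (a ∷ α ++ b ∷ w) E ≡ adjoin a E ∷ innerChain (α ++ b ∷ w) (adjoin a E)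
innerChain-∷ a b []      w E = refl
innerChain-∷ a b (c ∷ α) w E = refl

chain⇒word : (E T : Elem n L) (es : Chain n L) → IsElem E → IsElem T → All IsElem es →
  Linked _<w_ (E ∷ es ++ [ T ]) → rank T ≡ rank E + suc (length es) →
  Σ (ColWord n L) λ u → Fresh u E × innerChain u E ≡ es × adjoinWord u E ≡ T × length u ≡ suc (length es)
chain⇒word E T [] eE eT _ (E<T ∷ [-]) rank≡ with cover⇒adjoin eE eT (proj₁ E<T) (trans rank≡ (NP.+-comm (rank E) 1))
... | a , a∉E , refl = [ a ] , (a∉E , tt) , refl , refl , refl
chain⇒word E T (e ∷ es) eE eT (ee ∷ ees) (E<e ∷ e<) rank≡
  with squeeze (suc (length es)) (rank-mono-< eE ee E<e) (subst (rank e + suc (length es) ≤_) rank≡ (rank-between e T es ee eT ees e<))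
... | rank-e≡ with cover⇒adjoin eE ee (proj₁ E<e) rank-e≡
... | a , a∉E , refl
  with chain⇒word (adjoin a E) T es ee eT ees e<
         (trans rank≡ (trans (NP.+-suc (rank E) (suc (length es))) (cong (_+ suc (length es)) (sym rank-e≡))))
... | b ∷ u , f , inner≡ , top≡ , length≡ = a ∷ b ∷ u , (a∉E , f) , cong (adjoin a E ∷_) inner≡ , top≡ , cong suc length≡

gappedChain⇒word : (E T : Elem n L) (es : Chain n L) → IsElem E → IsElem T → All IsElem es →
  Linked _<w_ (E ∷ es ++ [ T ]) → rank T ≡ rank E + suc (suc (length es)) →
  Σ (ColWord n L) λ α → Σ (ColLetter n L) λ a → Σ (ColLetter n L) λ b → Σ (ColWord n L) λ β →
    Fresh (α ++ a ∷ b ∷ β) E × removeAtℕ (innerChain (α ++ a ∷ b ∷ β) E) (length α) ≡ es ×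
    adjoinWord (α ++ a ∷ b ∷ β) E ≡ T
gappedChain⇒word E T [] eE eT _ (E<T ∷ [-]) rank≡
  with adjoin-below eE eT (proj₁ E<T) (subst (rank E <_) (sym (trans rank≡ (NP.+-comm (rank E) 2))) (s≤s (NP.n≤1+n (rank E))))
... | a , a∉E , E′≤T
  with cover⇒adjoin (isElem-adjoin a E a∉E eE) eT E′≤T
         (trans rank≡ (trans (NP.+-comm (rank E) 2) (cong suc (sym (rank-adjoin a E a∉E)))))
... | b , b∉E′ , refl = [] , a , b , [] , (a∉E , b∉E′ , tt) , refl , refl
gappedChain⇒word E T (e ∷ es) eE eT (ee ∷ ees) (E<e ∷ e<) rank≡ with rank e NP.≟ suc (rank E)
... | yes rank-e≡ with cover⇒adjoin eE ee (proj₁ E<e) rank-e≡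
...   | a , a∉E , refl
  with gappedChain⇒word (adjoin a E) T es ee eT ees e<
         (trans rank≡ (trans (NP.+-suc (rank E) (suc (suc (length es)))) (cong (_+ suc (suc (length es))) (sym rank-e≡))))
...   | α , a′ , b′ , β , f , removed≡ , top≡ =
  a ∷ α , a′ , b′ , β , (a∉E , f) ,
  trans (cong (λ c → removeAtℕ c (suc (length α))) (innerChain-∷ a a′ α (b′ ∷ β) E)) (cong (adjoin a E ∷_) removed≡) , top≡
gappedChain⇒word E T (e ∷ es) eE eT (ee ∷ ees) (E<e ∷ e<) rank≡ | no rank-e≢
  with squeeze (suc (length es)) (NP.≤∧≢⇒< (rank-mono-< eE ee E<e) (rank-e≢ ∘ sym))
         (subst (rank e + suc (length es) ≤_) (trans rank≡ (NP.+-suc (rank E) (suc (suc (length es))))) (rank-between e T es ee eT ees e<))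
... | rank-e≡ with adjoin-below eE ee (proj₁ E<e) (rank-mono-< eE ee E<e)
... | a , a∉E , E′≤e
  with cover⇒adjoin (isElem-adjoin a E a∉E eE) ee E′≤e (trans rank-e≡ (cong suc (sym (rank-adjoin a E a∉E))))
... | b , b∉E′ , refl
  with chain⇒word (adjoin b (adjoin a E)) T es ee eT ees e<
         (trans rank≡ (trans (NP.+-suc (rank E) (suc (suc (length es))))
           (trans (cong suc (NP.+-suc (rank E) (suc (length es)))) (cong (_+ suc (length es)) (sym rank-e≡)))))
... | c ∷ u , f , inner≡ , top≡ , _ = [] , a , b , c ∷ u , (a∉E , b∉E′ , f) , cong (adjoin b (adjoin a E) ∷_) inner≡ , top≡

[]%=suc-injective : ∀ {m} (i j : Fin m) (ν : Vec ℕ m) → ν [ i ]%= suc ≡ ν [ j ]%= suc → i ≡ j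
[]%=suc-injective zero    zero    (a ∷ ν) _ = refl
[]%=suc-injective zero    (suc j) (a ∷ ν) e = ⊥-elim (NP.1+n≢n (VecP.∷-injectiveˡ e))
[]%=suc-injective (suc i) zero    (a ∷ ν) e = ⊥-elim (NP.1+n≢n (sym (VecP.∷-injectiveˡ e)))
[]%=suc-injective (suc i) (suc j) (a ∷ ν) e = cong suc ([]%=suc-injective i j ν (VecP.∷-injectiveʳ e))

[]≔true-injective : (B : Subset n) (x y : Fin n) → lookup B x ≡ false → B [ x ]≔ true ≡ B [ y ]≔ true → x ≡ y
[]≔true-injective B x y x∉B e with lookup-set⁻ B y (trans (cong (λ B′ → lookup B′ x) (sym e)) (lookup-set-≡ B x))
... | inj₁ y≡x = sym y≡x
... | inj₂ x∈B with () ← trans (sym x∈B) x∉B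

adjoin-injective : (a b : ColLetter n L) (E : Elem n L) → NotIn E a → adjoin a E ≡ adjoin b E → a ≡ b
adjoin-injective (x , i) (y , j) (B , ν) x∉B e =
  cong₂ _,_ ([]≔true-injective B x y x∉B (cong proj₁ e)) ([]%=suc-injective i j ν (cong proj₂ e))

innerChain-injective : (τ w : ColWord n L) (E : Elem n L) → Fresh τ E → length τ ≡ length w →
  innerChain τ E ≡ innerChain w E → adjoinWord τ E ≡ adjoinWord w E → τ ≡ w
innerChain-injective []          []          E _         _ _ _ = refl
innerChain-injective (a ∷ [])    (b ∷ [])    E (a∉E , _) _ _ e = cong [_] (adjoin-injective a b E a∉E e)
innerChain-injective (a ∷ a′ ∷ τ) (b ∷ b′ ∷ w) E (a∉E , f) length≡ inner≡ top≡ =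
  cong₂ _∷_ a≡b (innerChain-injective (a′ ∷ τ) (b′ ∷ w) (adjoin a E) f (NP.suc-injective length≡)
                  (trans (LP.∷-injectiveʳ inner≡) (cong (λ c → innerChain (b′ ∷ w) (adjoin c E)) (sym a≡b)))
                  (trans top≡ (cong (λ c → adjoinWord (b′ ∷ w) (adjoin c E)) (sym a≡b))))
  where a≡b = adjoin-injective a b E a∉E (LP.∷-injectiveˡ inner≡)
innerChain-injective []           (_ ∷ _)      _ _ () _ _
innerChain-injective (_ ∷ _)      []           _ _ () _ _
innerChain-injective (_ ∷ [])     (_ ∷ _ ∷ _)  _ _ () _ _
innerChain-injective (_ ∷ _ ∷ _)  (_ ∷ [])     _ _ () _ _

adjoinWord-++ : (α w : ColWord n L) (E : Elem n L) → adjoinWord (α ++ w) E ≡ adjoinWord w (adjoinWord α E)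
adjoinWord-++ []      w E = refl
adjoinWord-++ (a ∷ α) w E = adjoinWord-++ α w (adjoin a E)

fresh-++⁻ : (α w : ColWord n L) (E : Elem n L) → Fresh (α ++ w) E → Fresh α E × Fresh w (adjoinWord α E)
fresh-++⁻ []      w E f         = tt , f
fresh-++⁻ (a ∷ α) w E (a∉E , f) = let fα , fw = fresh-++⁻ α w (adjoin a E) f in (a∉E , fα) , fw

fresh-++⁺ : (α w : ColWord n L) (E : Elem n L) → Fresh α E → Fresh w (adjoinWord α E) → Fresh (α ++ w) E
fresh-++⁺ []      w E _         fw = fw
fresh-++⁺ (a ∷ α) w E (a∉E , fα) fw = a∉E , fresh-++⁺ α w (adjoin a E) fα fw

-- Removing the element at rank length α + 1 from the inner chain of α ++ u ∷ v ∷ β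
-- forgets u and v except for the element they lead to.
gap-swap : (α β : ColWord n L) (u v x y : ColLetter n L) (E : Elem n L) →
  adjoin v (adjoin u (adjoinWord α E)) ≡ adjoin y (adjoin x (adjoinWord α E)) →
  removeAtℕ (innerChain (α ++ u ∷ v ∷ β) E) (length α) ≡ removeAtℕ (innerChain (α ++ x ∷ y ∷ β) E) (length α)
gap-swap []      []      u v x y E e = refl
gap-swap []      (b ∷ β) u v x y E e = cong (λ F → F ∷ innerChain (b ∷ β) F) e
gap-swap (c ∷ α) β       u v x y E e = begin
  removeAtℕ (innerChain (c ∷ α ++ u ∷ v ∷ β) E) (suc (length α))
    ≡⟨ cong (λ cs → removeAtℕ cs (suc (length α))) (innerChain-∷ c u α (v ∷ β) E) ⟩
  adjoin c E ∷ removeAtℕ (innerChain (α ++ u ∷ v ∷ β) (adjoin c E)) (length α)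
    ≡⟨ cong (adjoin c E ∷_) (gap-swap α β u v x y (adjoin c E) e) ⟩
  adjoin c E ∷ removeAtℕ (innerChain (α ++ x ∷ y ∷ β) (adjoin c E)) (length α)
    ≡⟨ cong (λ cs → removeAtℕ cs (suc (length α))) (innerChain-∷ c x α (y ∷ β) E) ⟨
  removeAtℕ (innerChain (c ∷ α ++ x ∷ y ∷ β) E) (suc (length α))
    ∎
  where open ≡-Reasoning

gap-unswap : (α β τ : ColWord n L) (x y : ColLetter n L) (E : Elem n L) →
  Fresh τ E → Fresh (α ++ x ∷ y ∷ β) E → length τ ≡ length (α ++ x ∷ y ∷ β) →
  adjoinWord τ E ≡ adjoinWord (α ++ x ∷ y ∷ β) E →
  removeAtℕ (innerChain τ E) (length α) ≡ removeAtℕ (innerChain (α ++ x ∷ y ∷ β) E) (length α) →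
  ∃ λ u → ∃ λ v → τ ≡ α ++ u ∷ v ∷ β × adjoin v (adjoin u (adjoinWord α E)) ≡ adjoin y (adjoin x (adjoinWord α E))
gap-unswap [] []      (u ∷ v ∷ []) x y E _ _ _ top≡ _ = u , v , refl , top≡
gap-unswap [] (b ∷ β) (u ∷ v ∷ t ∷ τ) x y E (_ , _ , ft) (_ , _ , fb) length≡ top≡ gap≡
  = u , v , cong (λ w → u ∷ v ∷ w) (innerChain-injective (t ∷ τ) (b ∷ β) _ ft (NP.suc-injective (NP.suc-injective length≡))
                                       (trans (LP.∷-injectiveʳ gap≡) (cong (innerChain (b ∷ β)) (sym F≡)))
                                       (trans top≡ (cong (adjoinWord (b ∷ β)) (sym F≡)))) , F≡
  where F≡ = LP.∷-injectiveˡ gap≡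
gap-unswap (c ∷ α) β (t ∷ t′ ∷ τ) x y E (t∉E , ft) (_ , fw) length≡ top≡ gap≡
  with gap≡′ ← trans gap≡ (cong (λ cs → removeAtℕ cs (suc (length α))) (innerChain-∷ c x α (y ∷ β) E))
  with refl ← adjoin-injective t c E t∉E (LP.∷-injectiveˡ gap≡′)
  with u , v , τ≡ , e ← gap-unswap α β (t′ ∷ τ) x y (adjoin t E) ft fw
                          (NP.suc-injective length≡) top≡ (LP.∷-injectiveʳ gap≡′) =
  u , v , cong (t ∷_) τ≡ , e
gap-unswap [] []      (_ ∷ _ ∷ _ ∷ _) _ _ _ _ _ () _ _
gap-unswap [] (_ ∷ _) (_ ∷ _ ∷ [])    _ _ _ _ _ () _ _
gap-unswap [] _       []              _ _ _ _ _ () _ _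
gap-unswap [] _       (_ ∷ [])        _ _ _ _ _ () _ _
gap-unswap (_ ∷ _) _  []              _ _ _ _ _ () _ _
gap-unswap (_ ∷ []) _ (_ ∷ [])        _ _ _ _ _ () _ _
gap-unswap (_ ∷ _ ∷ _) _ (_ ∷ [])     _ _ _ _ _ () _ _

-- The pairs (u , v) for which adjoining u then v has the same effect as adjoining a then b:
-- the two (equal colors) or four (distinct colors) maximal chains of a length-two interval.
swapsOf : ColLetter n L → ColLetter n L → List (ColLetter n L × ColLetter n L)
swapsOf (x , i) (y , j) with i FinP.≟ j
... | yes _ = ((x , i) , (y , j)) ∷ ((y , j) , (x , i)) ∷ []
... | no  _ = ((x , i) , (y , j)) ∷ ((y , j) , (x , i)) ∷ ((y , i) , (x , j)) ∷ ((x , j) , (y , i)) ∷ []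

swapsOf-adjoin : (a b : ColLetter n L) (F : Elem n L) {u v : ColLetter n L} → (u , v) ∈ swapsOf a b →
  adjoin v (adjoin u F) ≡ adjoin b (adjoin a F)
swapsOf-adjoin (x , i) (y , j) F p with i FinP.≟ j | p
... | yes _ | here refl                         = refl
... | yes _ | there (here refl)                 = adjoin-comm (x , i) (y , j) F
... | no _  | here refl                         = refl
... | no _  | there (here refl)                 = adjoin-comm (x , i) (y , j) F
... | no _  | there (there (here refl))         = cong (_, _) ([]≔-commutes′ (proj₁ F) y x true)
... | no _  | there (there (there (here refl))) = cong (_ ,_) (updateAt-commutes′ (proj₂ F) j i suc)

fresh-swap : (B : Subset n) (x y : Fin n) → lookup B x ≡ false → lookup (B [ x ]≔ true) y ≡ false →
  lookup B y ≡ false × lookup (B [ y ]≔ true) x ≡ false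
fresh-swap B x y x∉B y∉B′ = let x≢y , y∉B = lookup-set-false B x y∉B′ in y∉B , trans (lookup-set-≢ B (x≢y ∘ sym)) x∉B

swapsOf-fresh : (a b : ColLetter n L) (F : Elem n L) → NotIn F a → NotIn (adjoin a F) b →
  {u v : ColLetter n L} → (u , v) ∈ swapsOf a b → NotIn F u × NotIn (adjoin u F) v
swapsOf-fresh (x , i) (y , j) (B , ν) x∉B y∉B′ p with i FinP.≟ j | p
... | yes _ | here refl                         = x∉B , y∉B′
... | yes _ | there (here refl)                 = fresh-swap B x y x∉B y∉B′
... | no _  | here refl                         = x∉B , y∉B′
... | no _  | there (here refl)                 = fresh-swap B x y x∉B y∉B′
... | no _  | there (there (here refl))         = fresh-swap B x y x∉B y∉B′
... | no _  | there (there (there (here refl))) = x∉B , y∉B′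

∈-set²⁻ : (B : Subset n) (x y z : Fin n) → lookup (B [ x ]≔ true [ y ]≔ true) z ≡ true → lookup B z ≡ false →
  z ≡ x ⊎ z ≡ y
∈-set²⁻ B x y z z∈ z∉B with lookup-set⁻ (B [ x ]≔ true) y z∈
... | inj₁ y≡z = inj₂ (sym y≡z)
... | inj₂ z∈′ with lookup-set⁻ B x z∈′
...   | inj₁ x≡z = inj₁ (sym x≡z)
...   | inj₂ z∈B with () ← trans (sym z∈B) z∉B

swapped-letters : (B : Subset n) (u v x y : Fin n) → lookup B u ≡ false → lookup (B [ u ]≔ true) v ≡ false →
  B [ u ]≔ true [ v ]≔ true ≡ B [ x ]≔ true [ y ]≔ true → (u ≡ x × v ≡ y) ⊎ (u ≡ y × v ≡ x)
swapped-letters B u v x y u∉B v∉B′ e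
  with ∈-set²⁻ B x y u (trans (cong (λ B′ → lookup B′ u) (sym e)) (lookup-set⁺ (B [ u ]≔ true) v (lookup-set-≡ B u))) u∉B
     | ∈-set²⁻ B x y v (trans (cong (λ B′ → lookup B′ v) (sym e)) (lookup-set-≡ (B [ u ]≔ true) v))
                       (proj₂ (lookup-set-false B u v∉B′))
... | inj₁ refl | inj₁ refl = ⊥-elim (proj₁ (lookup-set-false B u v∉B′) refl)
... | inj₁ u≡x  | inj₂ v≡y  = inj₁ (u≡x , v≡y)
... | inj₂ u≡y  | inj₁ v≡x  = inj₂ (u≡y , v≡x)
... | inj₂ refl | inj₂ refl = ⊥-elim (proj₁ (lookup-set-false B u v∉B′) refl)

swapped-colors : ∀ {m} (ν : Vec ℕ m) (c d i j : Fin m) → ν [ c ]%= suc [ d ]%= suc ≡ ν [ i ]%= suc [ j ]%= suc →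
  (c ≡ i × d ≡ j) ⊎ (c ≡ j × d ≡ i)
swapped-colors ν c d i j e with c FinP.≟ i
... | yes refl = inj₁ (refl , []%=suc-injective d j (ν [ c ]%= suc) e)
... | no c≢i with c FinP.≟ j
...   | yes refl = inj₂ (refl , []%=suc-injective d i (ν [ c ]%= suc) (trans e (updateAt-commutes′ ν i c suc)))
...   | no c≢j = ⊥-elim (NP.<-irrefl refl (begin-strict
  lookup ν c                             <⟨ NP.≤-reflexive (sym (VecP.lookup∘updateAt c ν)) ⟩
  lookup (ν [ c ]%= suc) c               ≤⟨ lookup-[]%=suc-≥ d c (ν [ c ]%= suc) ⟩
  lookup (ν [ c ]%= suc [ d ]%= suc) c   ≡⟨ cong (λ ν′ → lookup ν′ c) e ⟩
  lookup (ν [ i ]%= suc [ j ]%= suc) c   ≡⟨ VecP.lookup∘updateAt′ c j c≢j (ν [ i ]%= suc) ⟩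
  lookup (ν [ i ]%= suc) c               ≡⟨ VecP.lookup∘updateAt′ c i c≢i ν ⟩
  lookup ν c                             ∎))
  where
  open NP.≤-Reasoning
  lookup-[]%=suc-≥ : ∀ {m} (d c : Fin m) (ν : Vec ℕ m) → lookup ν c ≤ lookup (ν [ d ]%= suc) c
  lookup-[]%=suc-≥ d c ν with d FinP.≟ c
  ... | yes refl = NP.≤-trans (NP.n≤1+n _) (NP.≤-reflexive (sym (VecP.lookup∘updateAt d ν)))
  ... | no d≢c   = NP.≤-reflexive (sym (VecP.lookup∘updateAt′ c d (d≢c ∘ sym) ν))

swapsOf-complete : (a b u v : ColLetter n L) (F : Elem n L) → NotIn F u → NotIn (adjoin u F) v →
  adjoin v (adjoin u F) ≡ adjoin b (adjoin a F) → (u , v) ∈ swapsOf a b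
swapsOf-complete (x , i) (y , j) (ux , uc) (vx , vc) (B , ν) u∉B v∉B′ e
  with i FinP.≟ j | swapped-letters B ux vx x y u∉B v∉B′ (cong proj₁ e) | swapped-colors ν uc vc i j (cong proj₂ e)
... | yes refl | inj₁ (refl , refl) | inj₁ (refl , refl) = here refl
... | yes refl | inj₁ (refl , refl) | inj₂ (refl , refl) = here refl
... | yes refl | inj₂ (refl , refl) | inj₁ (refl , refl) = there (here refl)
... | yes refl | inj₂ (refl , refl) | inj₂ (refl , refl) = there (here refl)
... | no _     | inj₁ (refl , refl) | inj₁ (refl , refl) = here refl
... | no _     | inj₂ (refl , refl) | inj₂ (refl , refl) = there (here refl)
... | no _     | inj₂ (refl , refl) | inj₁ (refl , refl) = there (there (here refl))
... | no _     | inj₁ (refl , refl) | inj₂ (refl , refl) = there (there (there (here refl)))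

swapsOf-unique : (a b : ColLetter n L) → proj₁ a ≢ proj₁ b → Unique (swapsOf a b)
swapsOf-unique (x , i) (y , j) x≢y with i FinP.≟ j
... | yes _ = (x≢y ∘ letter ∷ []) ∷ [] ∷ []
  where letter = cong (proj₁ ∘ proj₁)
... | no i≢j = (x≢y ∘ letter ∷ x≢y ∘ letter ∷ i≢j ∘ color ∷ [])
             ∷ ((i≢j ∘ sym) ∘ color ∷ (x≢y ∘ sym) ∘ letter ∷ [])
             ∷ ((x≢y ∘ sym) ∘ letter ∷ [])
             ∷ [] ∷ []
  where
  letter = cong (proj₁ ∘ proj₁)
  color  = cong (proj₂ ∘ proj₁)

variants : ColWord n L → ColWord n L → ColLetter n L → ColLetter n L → List (ColWord n L)
variants α β a b = map (λ (u , v) → α ++ u ∷ v ∷ β) (swapsOf a b)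

∈-swapsOf₁ : (x y : Fin n) (i j : Fin L) → ((x , i) , (y , j)) ∈ swapsOf (x , i) (y , j)
∈-swapsOf₁ x y i j with i FinP.≟ j
... | yes _ = here refl
... | no _  = here refl

∈-swapsOf₂ : (x y : Fin n) (i j : Fin L) → ((y , j) , (x , i)) ∈ swapsOf (x , i) (y , j)
∈-swapsOf₂ x y i j with i FinP.≟ j
... | yes _ = there (here refl)
... | no _  = there (here refl)

∈-swapsOf₃ : (x y : Fin n) (i j : Fin L) → i ≢ j → ((y , i) , (x , j)) ∈ swapsOf (x , i) (y , j)
∈-swapsOf₃ x y i j i≢j with i FinP.≟ j
... | yes i≡j = ⊥-elim (i≢j i≡j)
... | no _    = there (there (here refl))

∈-swapsOf₄ : (x y : Fin n) (i j : Fin L) → i ≢ j → ((x , j) , (y , i)) ∈ swapsOf (x , i) (y , j)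
∈-swapsOf₄ x y i j i≢j with i FinP.≟ j
... | yes i≡j = ⊥-elim (i≢j i≡j)
... | no _    = there (there (there (here refl)))

innerRanks : ℕ → ℕ → List ℕ
innerRanks r zero          = []
innerRanks r (suc zero)    = []
innerRanks r (suc (suc m)) = suc r ∷ innerRanks (suc r) (suc m)

innerRanks-increasing : ∀ r m → Linked _<_ (innerRanks r m)
innerRanks-increasing r zero                = []
innerRanks-increasing r (suc zero)          = []
innerRanks-increasing r (suc (suc zero))    = [-]
innerRanks-increasing r (suc (suc (suc m))) = NP.≤-refl ∷ innerRanks-increasing (suc r) (suc (suc m))

map-rank-innerChain : (u : ColWord n L) (E : Elem n L) → Fresh u E → map rank (innerChain u E) ≡ innerRanks (rank E) (length u)
map-rank-innerChain []          E _         = refl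
map-rank-innerChain (a ∷ [])    E _         = refl
map-rank-innerChain (a ∷ b ∷ u) E (a∉E , f) =
  trans (cong (rank (adjoin a E) ∷_) (map-rank-innerChain (b ∷ u) (adjoin a E) f))
        (cong (λ r → r ∷ innerRanks r (suc (length u))) (rank-adjoin a E a∉E))

-- Maximal and corank-one chains of the interval [0̂, [n]^μ]

length-cbar : (σ : ColWord n L) → length (cbar σ) ≡ n ∸ 1
length-cbar {n} σ = trans (LP.length-map _ (upTo (n ∸ 1))) (LP.length-upTo (n ∸ 1))

module _ (μ : Vec ℕ L) where

  cbar-injective : {σ τ : ColWord n L} → ColPermWord μ σ → ColPermWord μ τ → cbar σ ≡ cbar τ → σ ≡ τ
  cbar-injective {σ = σ} {τ} σ̂ τ̂ e = innerChain-injective σ τ 0̂ (fresh σ̂) (trans (length≡ σ̂) (sym (length≡ τ̂)))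
    (trans (sym (cbar≡innerChain σ (length≡ σ̂))) (trans e (cbar≡innerChain τ (length≡ τ̂))))
    (trans (reaches σ̂) (sym (reaches τ̂)))

  map-rank-cbar : {τ : ColWord n L} → ColPermWord μ τ → map rank (cbar τ) ≡ innerRanks (rank (0̂ {n} {L})) n
  map-rank-cbar {n} {τ} τ̂ = begin
    map rank (cbar τ)             ≡⟨ cong (map rank) (cbar≡innerChain τ (length≡ τ̂)) ⟩
    map rank (innerChain τ 0̂)     ≡⟨ map-rank-innerChain τ 0̂ (fresh τ̂) ⟩
    innerRanks r₀ (length τ)      ≡⟨ cong (innerRanks r₀) (length≡ τ̂) ⟩
    innerRanks r₀ n               ∎
    where
    open ≡-Reasoning
    r₀ = rank (0̂ {n} {L})

  -- all maximal chains have the same ranks, so removing different positions gives different chains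
  cbar-removeAtℕ-≢ : {τ w : ColWord n L} → ColPermWord μ τ → ColPermWord μ w → {t k : ℕ} → t ≢ k →
    t < length (cbar τ) → k < length (cbar τ) → removeAtℕ (cbar τ) t ≢ removeAtℕ (cbar w) k
  cbar-removeAtℕ-≢ {n} {τ} {w} τ̂ ŵ {t} {k} t≢k t< k< e =
    removeAtℕ-increasing-≢ ranks (innerRanks-increasing _ n) t≢k (subst (t <_) ∣cbar∣≡ t<) (subst (k <_) ∣cbar∣≡ k<) ranks-≡
    where
    ranks = innerRanks (rank (0̂ {n} {L})) n
    ∣cbar∣≡ : length (cbar τ) ≡ length ranks
    ∣cbar∣≡ = trans (sym (LP.length-map rank (cbar τ))) (cong length (map-rank-cbar τ̂))
    ranks-≡ : removeAtℕ ranks t ≡ removeAtℕ ranks k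
    ranks-≡ = begin
      removeAtℕ ranks t                 ≡⟨ cong (λ rs → removeAtℕ rs t) (map-rank-cbar τ̂) ⟨
      removeAtℕ (map rank (cbar τ)) t   ≡⟨ map-removeAtℕ rank (cbar τ) t ⟨
      map rank (removeAtℕ (cbar τ) t)   ≡⟨ cong (map rank) e ⟩
      map rank (removeAtℕ (cbar w) k)   ≡⟨ map-removeAtℕ rank (cbar w) k ⟩
      removeAtℕ (map rank (cbar w)) k   ≡⟨ cong (λ rs → removeAtℕ rs k) (map-rank-cbar ŵ) ⟩
      removeAtℕ ranks k                 ∎
      where open ≡-Reasoning

  letter-supp : (α β : ColWord n L) (a : ColLetter n L) → adjoinWord (α ++ a ∷ β) 0̂ ≡ top μ → supp μ (proj₂ a)
  letter-supp α β (x , i) reaches′ μi≡0 = case subst (suc (lookup (proj₂ F) i) ≤_) μi≡0 bound of λ ()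
    where
    F = adjoinWord α 0̂
    below : adjoin (x , i) F ≤w top μ
    below = subst (adjoin (x , i) F ≤w_) (trans (sym (adjoinWord-++ α ((x , i) ∷ β) 0̂)) reaches′)
                  (≤w-adjoinWord β (adjoin (x , i) F))
    bound : suc (lookup (proj₂ F) i) ≤ lookup μ i
    bound = subst (_≤ lookup μ i) (VecP.lookup∘updateAt i (proj₂ F)) (PW.lookup (proj₂ below) i)

  module _ (α β : ColWord n L) (a b : ColLetter n L) (ŵ : ColPermWord μ (α ++ a ∷ b ∷ β)) where

    private
      F = adjoinWord α 0̂
      a∉F = proj₁ (proj₂ (fresh-++⁻ α (a ∷ b ∷ β) 0̂ (fresh ŵ)))
      b∉F′ = proj₁ (proj₂ (proj₂ (fresh-++⁻ α (a ∷ b ∷ β) 0̂ (fresh ŵ))))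
      β-fresh = proj₂ (proj₂ (proj₂ (fresh-++⁻ α (a ∷ b ∷ β) 0̂ (fresh ŵ))))

    variant-colPermWord : {τ : ColWord n L} → τ ∈ variants α β a b → ColPermWord μ τ
    variant-colPermWord τ∈ with MP.∈-map⁻ _ τ∈
    ... | (u , v) , uv∈ , refl = record
      { fresh   = fresh-++⁺ α (u ∷ v ∷ β) 0̂ (proj₁ (fresh-++⁻ α _ 0̂ (fresh ŵ)))
                    (u∉F , v∉F′ , subst (Fresh β) (sym (swapsOf-adjoin a b F uv∈)) β-fresh)
      ; length≡ = trans (LP.length-++ α) (trans (sym (LP.length-++ α)) (length≡ ŵ))
      ; reaches = begin
          adjoinWord (α ++ u ∷ v ∷ β) 0̂    ≡⟨ adjoinWord-++ α (u ∷ v ∷ β) 0̂ ⟩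
          adjoinWord β (adjoin v (adjoin u F)) ≡⟨ cong (adjoinWord β) (swapsOf-adjoin a b F uv∈) ⟩
          adjoinWord β (adjoin b (adjoin a F)) ≡⟨ adjoinWord-++ α (a ∷ b ∷ β) 0̂ ⟨
          adjoinWord (α ++ a ∷ b ∷ β) 0̂    ≡⟨ reaches ŵ ⟩
          top μ                            ∎
      }
      where
      open ≡-Reasoning
      u∉F  = proj₁ (swapsOf-fresh a b F a∉F b∉F′ uv∈)
      v∉F′ = proj₂ (swapsOf-fresh a b F a∉F b∉F′ uv∈)

    variant⇒gap-≡ : {τ : ColWord n L} → τ ∈ variants α β a b →
      removeAtℕ (cbar τ) (length α) ≡ removeAtℕ (cbar (α ++ a ∷ b ∷ β)) (length α)
    variant⇒gap-≡ τ∈ with MP.∈-map⁻ _ τ∈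
    ... | (u , v) , uv∈ , refl = begin
      removeAtℕ (cbar (α ++ u ∷ v ∷ β)) (length α)
        ≡⟨ cong (λ cs → removeAtℕ cs (length α)) (cbar≡innerChain (α ++ u ∷ v ∷ β) (length≡ (variant-colPermWord τ∈))) ⟩
      removeAtℕ (innerChain (α ++ u ∷ v ∷ β) 0̂) (length α)
        ≡⟨ gap-swap α β u v a b 0̂ (swapsOf-adjoin a b F uv∈) ⟩
      removeAtℕ (innerChain (α ++ a ∷ b ∷ β) 0̂) (length α)
        ≡⟨ cong (λ cs → removeAtℕ cs (length α)) (cbar≡innerChain (α ++ a ∷ b ∷ β) (length≡ ŵ)) ⟨
      removeAtℕ (cbar (α ++ a ∷ b ∷ β)) (length α)
        ∎
      where open ≡-Reasoning

    gap-≡⇒variant : {τ : ColWord n L} → ColPermWord μ τ →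
      removeAtℕ (cbar τ) (length α) ≡ removeAtℕ (cbar (α ++ a ∷ b ∷ β)) (length α) → τ ∈ variants α β a b
    gap-≡⇒variant {τ} τ̂ gap≡
      with gap-unswap α β τ a b 0̂ (fresh τ̂) (fresh ŵ) (trans (length≡ τ̂) (sym (length≡ ŵ)))
                      (trans (reaches τ̂) (sym (reaches ŵ)))
             (trans (cong (λ cs → removeAtℕ cs (length α)) (sym (cbar≡innerChain τ (length≡ τ̂))))
               (trans gap≡ (cong (λ cs → removeAtℕ cs (length α)) (cbar≡innerChain (α ++ a ∷ b ∷ β) (length≡ ŵ)))))
    ... | u , v , refl , e =
      let _ , u∉F , v∉F′ , _ = fresh-++⁻ α (u ∷ v ∷ β) 0̂ (fresh τ̂)
      in MP.∈-map⁺ (λ (u , v) → α ++ u ∷ v ∷ β) (swapsOf-complete a b u v F u∉F v∉F′ e)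

    swap-isColPerm : {u v : ColLetter n L} → (u , v) ∈ swapsOf a b → IsColPerm μ (α ++ u ∷ v ∷ β)
    swap-isColPerm uv∈ = colPermWord⇒isColPerm μ (variant-colPermWord (MP.∈-map⁺ _ uv∈))

    supp-first : supp μ (proj₂ a)
    supp-first = letter-supp α (b ∷ β) a (reaches ŵ)

    supp-second : supp μ (proj₂ b)
    supp-second = letter-supp (α ++ [ a ]) β b (trans (cong (λ u → adjoinWord u 0̂) (LP.++-assoc α [ a ] (b ∷ β))) (reaches ŵ))

    gap-letters-≢ : proj₁ a ≢ proj₁ b
    gap-letters-≢ = proj₁ (lookup-set-false (proj₁ F) (proj₁ a) b∉F′)

    variants-unique : Unique (variants α β a b)
    variants-unique = UniqueP.map⁺ injective (swapsOf-unique a b gap-letters-≢)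
      where
      injective : ∀ {p q : ColLetter n L × ColLetter n L} →
                  α ++ proj₁ p ∷ proj₂ p ∷ β ≡ α ++ proj₁ q ∷ proj₂ q ∷ β → p ≡ q
      injective e = let e′ = LP.++-cancelˡ α _ _ e in cong₂ _,_ (LP.∷-injectiveˡ e′) (LP.∷-injectiveˡ (LP.∷-injectiveʳ e′))

module _ {n : ℕ} (μ : Vec ℕ L) (∣μ∣≡n : ∣ μ ∣w ≡ n) (n≥1 : 1 ≤ n) where

  private
    isElem-top : IsElem (top {n} μ)
    isElem-top = trans ∣μ∣≡n (sym (SP.∣⊤∣≡n n))

    rank-top : rank (top {n} μ) ≡ rank (0̂ {n} {L}) + n
    rank-top = trans (SP.∣⊤∣≡n n) (cong (_+ n) (sym (SP.∣⊥∣≡0 n)))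

    0̂<top : 0̂ <w top {n} μ
    0̂<top = 0̂-minimum _ , λ e → NP.<-irrefl (trans (sym (SP.∣⊥∣≡0 n)) (trans (cong rank e) (SP.∣⊤∣≡n n))) n≥1

    linked-0̂-top : (cs : Chain n L) → IsChain μ cs → Linked _<w_ (0̂ ∷ cs ++ [ top μ ])
    linked-0̂-top cs (inOpen , linked) =
      Linked-∷ (AllP.++⁺ (All.map (proj₁ ∘ proj₂) inOpen) (0̂<top ∷ []))
               (Linked-∷ʳ cs linked (All.map (proj₂ ∘ proj₂) inOpen))

  maxChain⇒cbar : (cm : Chain n L) → IsMaxChain μ cm → ∃ λ τ → IsColPerm μ τ × cbar τ ≡ cm
  maxChain⇒cbar cm (chain , ∣cm∣≡)
    with u , f , inner≡ , top≡ , ∣u∣≡ ← chain⇒word 0̂ (top μ) cm (isElem-0̂ {n} {L}) isElem-top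
                                          (All.map proj₁ (proj₁ chain)) (linked-0̂-top cm chain)
                                          (trans rank-top (cong (rank (0̂ {n} {L}) +_) (sym ∣cm∣≡)))
    = u , reachesTop⇒isColPerm μ u f top≡ , trans (cbar≡innerChain u (trans ∣u∣≡ ∣cm∣≡)) inner≡

  subMaxChain⇒gap : (d : Chain n L) → IsSubMaxChain μ d →
    Σ (ColWord n L) λ α → Σ (ColLetter n L) λ a → Σ (ColLetter n L) λ b → Σ (ColWord n L) λ β →
      ColPermWord μ (α ++ a ∷ b ∷ β) × d ≡ removeAtℕ (cbar (α ++ a ∷ b ∷ β)) (length α)
  subMaxChain⇒gap d (chain , ∣d∣≡)
    with α , a , b , β , f , removed≡ , top≡ ← gappedChain⇒word 0̂ (top μ) d (isElem-0̂ {n} {L}) isElem-top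
                                                 (All.map proj₁ (proj₁ chain)) (linked-0̂-top d chain)
                                                 (trans rank-top (cong (rank (0̂ {n} {L}) +_) (sym ∣d∣≡)))
    = α , a , b , β , ŵ ,
      trans (sym removed≡) (cong (λ cs → removeAtℕ cs (length α)) (sym (cbar≡innerChain (α ++ a ∷ b ∷ β) (length≡ ŵ))))
    where ŵ = isColPerm⇒colPermWord μ _ (reachesTop⇒isColPerm μ _ f top≡)

  gap-isSubMaxChain : {w : ColWord n L} → ColPermWord μ w → (k : ℕ) → k < length (cbar w) → IsSubMaxChain μ (removeAtℕ (cbar w) k)
  gap-isSubMaxChain {w} ŵ k k< with (inOpen , linked) , ∣cbar∣≡ ← cbar-isMaxChain μ w n≥1 ŵ =
    (All-removeAtℕ (cbar w) k inOpen , Linked-removeAtℕ <w-trans (cbar w) k linked) ,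
    trans (cong suc (length-removeAtℕ (cbar w) k k<)) ∣cbar∣≡

-- Linear algebra over the field, and the coboundaries of corank-one chains

module LinearAlgebra {c ℓ : Level} (𝕜 : Field c ℓ) where

  open Field 𝕜 using (Carrier; _≈_; 0#; 1#; -_; +-cong; +-congˡ; *-cong; *-congˡ; +-identityˡ; +-identityʳ; *-identityˡ;
                      zeroʳ; *-assoc; +-assoc; -‿cong; -‿inverseʳ; ring)
                 renaming (_+_ to _⊕_; _*_ to _⊗_)
  module 𝕜 = Field 𝕜
  open Lin 𝕜
  module ≈-Reasoning = Relation.Binary.Reasoning.Setoid 𝕜.setoid

  sgn-square : ∀ k → sgn k ⊗ sgn k ≈ 1#
  sgn-square zero    = *-identityˡ 1#
  sgn-square (suc k) = begin
    - sgn k ⊗ - sgn k     ≈⟨ -‿distribˡ-* (sgn k) (- sgn k) ⟨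
    - (sgn k ⊗ - sgn k)   ≈⟨ -‿cong (-‿distribʳ-* (sgn k) (sgn k)) ⟨
    - - (sgn k ⊗ sgn k)   ≈⟨ -‿involutive _ ⟩
    sgn k ⊗ sgn k         ≈⟨ sgn-square k ⟩
    1#                    ∎
    where
    open ≈-Reasoning
    open import Algebra.Properties.Ring ring using (-‿distribˡ-*; -‿distribʳ-*; -‿involutive)

  sgn-cancel : ∀ k x → x ≈ sgn k ⊗ (sgn k ⊗ x)
  sgn-cancel k x = begin
    x                     ≈⟨ *-identityˡ x ⟨
    1# ⊗ x                ≈⟨ *-cong (sgn-square k) 𝕜.refl ⟨
    (sgn k ⊗ sgn k) ⊗ x   ≈⟨ *-assoc _ _ _ ⟩
    sgn k ⊗ (sgn k ⊗ x)   ∎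
    where open ≈-Reasoning

  module _ {a} {A : Set a} (_≟_ : DecidableEquality A) where

    ind-≡ : {x y : A} → x ≡ y → ind _≟_ x y ≡ 1#
    ind-≡ {x} {y} x≡y with x ≟ y
    ... | yes _  = refl
    ... | no x≢y = ⊥-elim (x≢y x≡y)

    ind-≢ : {x y : A} → x ≢ y → ind _≟_ x y ≡ 0#
    ind-≢ {x} {y} x≢y with x ≟ y
    ... | yes x≡y = ⊥-elim (x≢y x≡y)
    ... | no _    = refl

    Σ-ind-∉ : (vs : List A) {v : A} → All (_≢ v) vs → Σ-list (λ u → ind _≟_ u v) vs ≈ 0#
    Σ-ind-∉ []       []           = 𝕜.refl
    Σ-ind-∉ (u ∷ vs) (u≢v ∷ vs≢v) = 𝕜.trans (+-cong (𝕜.reflexive (ind-≢ u≢v)) (Σ-ind-∉ vs vs≢v)) (+-identityʳ 0#)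

    Σ-ind-∈ : (vs : List A) {v : A} → Unique vs → v ∈ vs → Σ-list (λ u → ind _≟_ u v) vs ≈ 1#
    Σ-ind-∈ (u ∷ vs) (u∉vs ∷ _) (here refl) =
      𝕜.trans (+-cong (𝕜.reflexive (ind-≡ refl)) (Σ-ind-∉ vs (All.map (_∘ sym) u∉vs))) (+-identityʳ 1#)
    Σ-ind-∈ (u ∷ vs) (u∉vs ∷ uniq) (there v∈vs) =
      𝕜.trans (+-cong (𝕜.reflexive (ind-≢ (All.lookup u∉vs v∈vs))) (Σ-ind-∈ vs uniq v∈vs)) (+-identityˡ 1#)

  ind≈Σ-ind : ∀ {a b} {A : Set a} {B : Set b} (_≟A_ : DecidableEquality A) (_≟B_ : DecidableEquality B)
    {x y : A} {vs : List B} {v : B} → Unique vs → (x ≡ y → v ∈ vs) → (v ∈ vs → x ≡ y) →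
    ind _≟A_ x y ≈ Σ-list (λ u → ind _≟B_ u v) vs
  ind≈Σ-ind _≟A_ _≟B_ {x} {y} {vs} uniq to from with x ≟A y
  ... | yes x≡y = 𝕜.sym (Σ-ind-∈ _≟B_ vs uniq (to x≡y))
  ... | no x≢y  = 𝕜.sym (Σ-ind-∉ _≟B_ vs (All.map (_∘ sym) (AllP.¬Any⇒All¬ vs (x≢y ∘ from))))

  ind-cong : ∀ {a b} {A : Set a} {B : Set b} (_≟A_ : DecidableEquality A) (_≟B_ : DecidableEquality B)
    {x y : A} {x′ y′ : B} → (x ≡ y → x′ ≡ y′) → (x′ ≡ y′ → x ≡ y) → ind _≟A_ x y ≡ ind _≟B_ x′ y′
  ind-cong _≟A_ _≟B_ {x} {y} to from with x ≟A y
  ... | yes x≡y = sym (ind-≡ _≟B_ (to x≡y))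
  ... | no x≢y  = sym (ind-≢ _≟B_ (x≢y ∘ from))

  Σ-cong-All : ∀ {a p} {A : Set a} {P : A → Set p} {f g : A → Carrier} (xs : List A) → All P xs →
    (∀ x → P x → f x ≈ g x) → Σ-list f xs ≈ Σ-list g xs
  Σ-cong-All []       []       _   = 𝕜.refl
  Σ-cong-All (x ∷ xs) (p ∷ ps) f≈g = +-cong (f≈g x p) (Σ-cong-All xs ps f≈g)

  Σ-zero : ∀ {a} {A : Set a} {f : A → Carrier} (xs : List A) → All (λ x → f x ≈ 0#) xs → Σ-list f xs ≈ 0#
  Σ-zero []       []        = 𝕜.refl
  Σ-zero (x ∷ xs) (z ∷ zs) = 𝕜.trans (+-cong z (Σ-zero xs zs)) (+-identityʳ 0#)

  Σ-tabulate-single : ∀ {a} {A : Set a} {m} (h : A → Carrier) (g : Fin m → A) (k : Fin m) →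
    (∀ j → j ≢ k → h (g j) ≈ 0#) → Σ-list h (List.tabulate g) ≈ h (g k)
  Σ-tabulate-single h g zero    zeros =
    𝕜.trans (+-congˡ (Σ-zero _ (AllP.tabulate⁺ λ j → zeros (suc j) λ ()))) (+-identityʳ _)
  Σ-tabulate-single h g (suc k) zeros =
    𝕜.trans (+-cong (zeros zero λ ()) (Σ-tabulate-single h (g ∘ suc) k λ j j≢k → zeros (suc j) (j≢k ∘ FinP.suc-injective)))
            (+-identityˡ _)

  Σ-transport : ∀ {a b t p q d} {A : Set a} {B : Set b} {T : Set t} {P : A → Set p} {Q : B → Set q} {D : T → Set d}
    (f : A → T → Carrier) (g : B → T → Carrier) →
    (∀ x → P x → Σ B λ y → Σ Carrier λ s → Q y × (∀ z → D z → f x z ≈ s ⊗ g y z)) →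
    (xs : List (Carrier × A)) → All (P ∘ proj₂) xs →
    Σ (List (Carrier × B)) λ ys → All (Q ∘ proj₂) ys ×
      (∀ z → D z → Σ-list (λ p → proj₁ p ⊗ f (proj₂ p) z) xs ≈ Σ-list (λ p → proj₁ p ⊗ g (proj₂ p) z) ys)
  Σ-transport f g convert []             []         = [] , [] , λ _ _ → 𝕜.refl
  Σ-transport f g convert ((r , x) ∷ xs) (px ∷ pxs)
    with y , s , qy , f≈g ← convert x px | ys , qys , Σ≈ ← Σ-transport f g convert xs pxs =
    (r ⊗ s , y) ∷ ys , qy ∷ qys , λ z dz → +-cong (𝕜.trans (*-congˡ (f≈g z dz)) (𝕜.sym (*-assoc r s _))) (Σ≈ z dz)

  relationVector : ∀ {n L} → ColWord n L → ColWord n L → ColLetter n L → ColLetter n L → ColWord n L → Carrier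
  relationVector α β a b w = Σ-list (λ v → ind _≟W_ v w) (variants α β a b)

  module _ {n L : ℕ} (μ : Vec ℕ L) where

    cobCoeff-gap : {τ w : ColWord n L} → ColPermWord μ τ → ColPermWord μ w → (k : ℕ) → k < length (cbar τ) →
      cobCoeff (removeAtℕ (cbar w) k) (cbar τ) ≈ sgn k ⊗ ind _≟C_ (removeAtℕ (cbar τ) k) (removeAtℕ (cbar w) k)
    cobCoeff-gap {τ} {w} τ̂ ŵ k k< = begin
      cobCoeff d (cbar τ)
        ≈⟨ Σ-tabulate-single h (λ j → j) k̂ off-k̂ ⟩
      sgn (toℕ k̂) ⊗ ind _≟C_ (List.removeAt (cbar τ) k̂) d
        ≡⟨ cong (λ cs → sgn (toℕ k̂) ⊗ ind _≟C_ cs d) (removeAt≡removeAtℕ (cbar τ) k̂) ⟩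
      sgn (toℕ k̂) ⊗ ind _≟C_ (removeAtℕ (cbar τ) (toℕ k̂)) d
        ≡⟨ cong (λ t → sgn t ⊗ ind _≟C_ (removeAtℕ (cbar τ) t) d) (FinP.toℕ-fromℕ< k<) ⟩
      sgn k ⊗ ind _≟C_ (removeAtℕ (cbar τ) k) d
        ∎
      where
      open ≈-Reasoning
      d  = removeAtℕ (cbar w) k
      k̂  = fromℕ< k<
      h  = λ j → sgn (toℕ j) ⊗ ind _≟C_ (List.removeAt (cbar τ) j) d
      off-k̂ : ∀ j → j ≢ k̂ → h j ≈ 0#
      off-k̂ j j≢k̂ = 𝕜.trans (*-congˡ (𝕜.reflexive (ind-≢ _≟C_ removed≢))) (zeroʳ _)
        where
        removed≢ : List.removeAt (cbar τ) j ≢ d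
        removed≢ = cbar-removeAtℕ-≢ μ τ̂ ŵ (λ e → j≢k̂ (FinP.toℕ-injective (trans e (sym (FinP.toℕ-fromℕ< k<)))))
                     (FinP.toℕ<n j) k< ∘ trans (sym (removeAt≡removeAtℕ (cbar τ) j))

    module _ (α β : ColWord n L) (a b : ColLetter n L) (ŵ : ColPermWord μ (α ++ a ∷ b ∷ β)) where

      gap<length-cbar : {τ : ColWord n L} → length α < length (cbar τ)
      gap<length-cbar {τ} = subst (length α <_) (sym ∣cbar∣≡) (NP.m<m+n (length α) (s≤s z≤n))
        where
        ∣w∣≡n : length α + suc (suc (length β)) ≡ n
        ∣w∣≡n = trans (sym (LP.length-++ α)) (length≡ ŵ)
        ∣cbar∣≡ : length (cbar τ) ≡ length α + suc (length β)
        ∣cbar∣≡ = trans (length-cbar τ) (cong (_∸ 1) (trans (sym ∣w∣≡n) (NP.+-suc (length α) (suc (length β)))))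

      cobCoeff-gap≈relationVector : {τ : ColWord n L} → ColPermWord μ τ →
        cobCoeff (removeAtℕ (cbar (α ++ a ∷ b ∷ β)) (length α)) (cbar τ) ≈ sgn (length α) ⊗ relationVector α β a b τ
      cobCoeff-gap≈relationVector {τ} τ̂ = 𝕜.trans (cobCoeff-gap τ̂ ŵ (length α) (gap<length-cbar {τ}))
        (*-congˡ (ind≈Σ-ind _≟C_ _≟W_ (variants-unique μ α β a b ŵ)
                                       (gap-≡⇒variant μ α β a b ŵ τ̂) (variant⇒gap-≡ μ α β a b ŵ)))

    relationVector-vanishes : (α β : ColWord n L) (a b : ColLetter n L) → ColPermWord μ (α ++ a ∷ b ∷ β) →
      {w : ColWord n L} → ¬ IsColPerm μ w → relationVector α β a b w ≈ 0#
    relationVector-vanishes α β a b ŵ ¬cp = Σ-ind-∉ _≟W_ (variants α β a b) (All.tabulate λ v∈ v≡w →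
      ¬cp (subst (IsColPerm μ) v≡w (colPermWord⇒isColPerm μ (variant-colPermWord μ α β a b ŵ v∈))))

    relationVector-same : (α β : ColWord n L) (x y : Fin n) (i : Fin L) (w : ColWord n L) →
      relationVector α β (x , i) (y , i) w ≈
        ind _≟W_ (α ++ (x , i) ∷ (y , i) ∷ β) w ⊕ ind _≟W_ (α ++ (y , i) ∷ (x , i) ∷ β) w
    relationVector-same α β x y i w with i FinP.≟ i
    ... | yes _  = +-congˡ (+-identityʳ _)
    ... | no i≢i = ⊥-elim (i≢i refl)

    relationVector-distinct : (α β : ColWord n L) (x y : Fin n) (i j : Fin L) → i ≢ j → (w : ColWord n L) →
      relationVector α β (x , i) (y , j) w ≈
        ind _≟W_ (α ++ (x , i) ∷ (y , j) ∷ β) w ⊕ ind _≟W_ (α ++ (y , j) ∷ (x , i) ∷ β) w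
          ⊕ ind _≟W_ (α ++ (y , i) ∷ (x , j) ∷ β) w ⊕ ind _≟W_ (α ++ (x , j) ∷ (y , i) ∷ β) w
    relationVector-distinct α β x y i j i≢j w with i FinP.≟ j
    ... | yes i≡j = ⊥-elim (i≢j i≡j)
    ... | no _    = begin
      p ⊕ (q ⊕ (r ⊕ (s ⊕ 0#)))  ≈⟨ +-congˡ (+-congˡ (+-congˡ (+-identityʳ s))) ⟩
      p ⊕ (q ⊕ (r ⊕ s))         ≈⟨ +-assoc p q (r ⊕ s) ⟨
      (p ⊕ q) ⊕ (r ⊕ s)         ≈⟨ +-assoc (p ⊕ q) r s ⟨
      p ⊕ q ⊕ r ⊕ s             ∎
      where
      open ≈-Reasoning
      p = ind _≟W_ (α ++ (x , i) ∷ (y , j) ∷ β) w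
      q = ind _≟W_ (α ++ (y , j) ∷ (x , i) ∷ β) w
      r = ind _≟W_ (α ++ (y , i) ∷ (x , j) ∷ β) w
      s = ind _≟W_ (α ++ (x , j) ∷ (y , i) ∷ β) w

    Rel⇒relationVector : {g : ColWord n L → Carrier} → Rel μ g →
      Σ (ColWord n L) λ α → Σ (ColWord n L) λ β → Σ (ColLetter n L) λ a → Σ (ColLetter n L) λ b →
        ColPermWord μ (α ++ a ∷ b ∷ β) × (∀ w → g w ≈ relationVector α β a b w)
    Rel⇒relationVector (inj₁ (α , β , x , y , i , _ , _ , cp , _ , g≈)) =
      α , β , (x , i) , (y , i) , isColPerm⇒colPermWord μ _ cp , λ w → 𝕜.trans (g≈ w) (𝕜.sym (relationVector-same α β x y i w))
    Rel⇒relationVector (inj₂ (α , β , x , y , i , j , _ , _ , i≢j , _ , cp , _ , _ , _ , g≈)) =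
      α , β , (x , i) , (y , j) , isColPerm⇒colPermWord μ _ cp ,
      λ w → 𝕜.trans (g≈ w) (𝕜.sym (relationVector-distinct α β x y i j i≢j w))

    relationVector-Rel : (α β : ColWord n L) (a b : ColLetter n L) → ColPermWord μ (α ++ a ∷ b ∷ β) →
      Rel μ (relationVector α β a b)
    relationVector-Rel α β (x , i) (y , j) ŵ = case i FinP.≟ j of λ where
        (yes refl) → inj₁ (α , β , x , y , i , suppᵢ , x≢y , swap (∈-swapsOf₁ x y i i) , swap (∈-swapsOf₂ x y i i) ,
                           relationVector-same α β x y i)
        (no i≢j)   → inj₂ (α , β , x , y , i , j , suppᵢ , suppⱼ , i≢j , x≢y ,
                           swap (∈-swapsOf₁ x y i j) , swap (∈-swapsOf₂ x y i j) ,
                           swap (∈-swapsOf₃ x y i j i≢j) , swap (∈-swapsOf₄ x y i j i≢j) ,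
                           relationVector-distinct α β x y i j i≢j)
      where
      suppᵢ = supp-first μ α β (x , i) (y , j) ŵ
      suppⱼ = supp-second μ α β (x , i) (y , j) ŵ
      x≢y   = gap-letters-≢ μ α β (x , i) (y , j) ŵ
      swap  = swap-isColPerm μ α β (x , i) (y , j) ŵ

  module TopCohomology {n L : ℕ} (μ : Vec ℕ L) (∣μ∣≡n : ∣ μ ∣w ≡ n) (n≥1 : 1 ≤ n) where

    wordCombination : List (Carrier × ColWord n L) → ColWord n L → Carrier
    wordCombination as w = Σ-list (λ p → proj₁ p ⊗ ind _≟W_ (proj₂ p) w) as

    cbarImage≈wordCombination : (as : List (Carrier × ColWord n L)) → All (IsColPerm μ ∘ proj₂) as →
      {τ : ColWord n L} → ColPermWord μ τ → cbarImage as (cbar τ) ≈ wordCombination as τ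
    cbarImage≈wordCombination as cps τ̂ = Σ-cong-All as cps λ (_ , σ) cp →
      *-congˡ (𝕜.reflexive (ind-cong _≟C_ _≟W_ (cbar-injective μ (isColPerm⇒colPermWord μ σ cp) τ̂) (cong cbar)))

    wordCombination-vanishes : (as : List (Carrier × ColWord n L)) → All (IsColPerm μ ∘ proj₂) as →
      {w : ColWord n L} → ¬ IsColPerm μ w → wordCombination as w ≈ 0#
    wordCombination-vanishes as cps {w} ¬cp = Σ-zero as (All.map (λ {(_ , σ)} cp →
      𝕜.trans (*-congˡ (𝕜.reflexive (ind-≢ _≟W_ {σ} {w} λ { refl → ¬cp cp }))) (zeroʳ _)) cps)

    Rel-vanishes : {g : ColWord n L → Carrier} → Rel μ g → {w : ColWord n L} → ¬ IsColPerm μ w → g w ≈ 0#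
    Rel-vanishes r {w} ¬cp with α , β , a , b , ŵ , g≈ ← Rel⇒relationVector μ r =
      𝕜.trans (g≈ w) (relationVector-vanishes μ α β a b ŵ ¬cp)

    relation⇒coboundary : (g : ColWord n L → Carrier) → Rel μ g →
      Σ (Chain n L) λ d → Σ Carrier λ s → IsSubMaxChain μ d × (∀ τ → ColPermWord μ τ → g τ ≈ s ⊗ cobCoeff d (cbar τ))
    relation⇒coboundary g r with α , β , a , b , ŵ , g≈ ← Rel⇒relationVector μ r =
      removeAtℕ (cbar (α ++ a ∷ b ∷ β)) (length α) , sgn (length α) ,
      gap-isSubMaxChain μ ∣μ∣≡n n≥1 ŵ (length α) (gap<length-cbar μ α β a b ŵ {α ++ a ∷ b ∷ β}) ,
      λ τ τ̂ → 𝕜.trans (g≈ τ) (𝕜.trans (sgn-cancel (length α) _)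
                                      (*-congˡ (𝕜.sym (cobCoeff-gap≈relationVector μ α β a b ŵ τ̂))))

    coboundary⇒relation : (d : Chain n L) → IsSubMaxChain μ d →
      Σ (ColWord n L → Carrier) λ g → Σ Carrier λ s → Rel μ g × (∀ τ → ColPermWord μ τ → cobCoeff d (cbar τ) ≈ s ⊗ g τ)
    coboundary⇒relation d sub with α , a , b , β , ŵ , refl ← subMaxChain⇒gap μ ∣μ∣≡n n≥1 d sub =
      relationVector α β a b , sgn (length α) , relationVector-Rel μ α β a b ŵ ,
      λ τ τ̂ → cobCoeff-gap≈relationVector μ α β a b ŵ τ̂

    spanning : ∀ (cm : Chain n L) → IsMaxChain μ cm →
      ∃ λ (as : List (Carrier × ColWord n L)) →
        All (IsColPerm μ ∘ proj₂) as × InImδ μ (λ c′ → ind _≟C_ cm c′ 𝕜.- cbarImage as c′)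
    spanning cm max with τ , cp , refl ← maxChain⇒cbar μ ∣μ∣≡n n≥1 cm max =
      [ (1# , τ) ] , cp ∷ [] , [] , [] ,
      λ _ _ → 𝕜.trans (+-congˡ (-‿cong (𝕜.trans (+-identityʳ _) (*-identityˡ _)))) (-‿inverseʳ _)

    relations⇒coboundaries : (as : List (Carrier × ColWord n L)) → All (IsColPerm μ ∘ proj₂) as →
      InRelSpan μ (wordCombination as) → InImδ μ (cbarImage as)
    relations⇒coboundaries as cps (gs , rels , as≈gs)
      with ds , subs , gs≈ds ← Σ-transport (λ g τ → g τ) (λ d τ → cobCoeff d (cbar τ)) relation⇒coboundary gs rels =
      ds , subs , λ cm max → case maxChain⇒cbar μ ∣μ∣≡n n≥1 cm max of λ where
        (τ , cp , refl) → let τ̂ = isColPerm⇒colPermWord μ τ cp in begin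
          cbarImage as (cbar τ)                                   ≈⟨ cbarImage≈wordCombination as cps τ̂ ⟩
          wordCombination as τ                                    ≈⟨ as≈gs τ ⟩
          Σ-list (λ p → proj₁ p ⊗ proj₂ p τ) gs                   ≈⟨ gs≈ds τ τ̂ ⟩
          Σ-list (λ p → proj₁ p ⊗ cobCoeff (proj₂ p) (cbar τ)) ds ∎
      where open ≈-Reasoning

    coboundaries⇒relations : (as : List (Carrier × ColWord n L)) → All (IsColPerm μ ∘ proj₂) as →
      InImδ μ (cbarImage as) → InRelSpan μ (wordCombination as)
    coboundaries⇒relations as cps (ds , subs , as≈ds)
      with gs , rels , ds≈gs ← Σ-transport (λ d τ → cobCoeff d (cbar τ)) (λ g τ → g τ) coboundary⇒relation ds subs =
      gs , rels , λ w → case isColPerm? μ w of λ where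
        (yes cp) → let ŵ = isColPerm⇒colPermWord μ w cp in begin
          wordCombination as w                                    ≈⟨ cbarImage≈wordCombination as cps ŵ ⟨
          cbarImage as (cbar w)                                   ≈⟨ as≈ds (cbar w) (cbar-isMaxChain μ w n≥1 ŵ) ⟩
          Σ-list (λ p → proj₁ p ⊗ cobCoeff (proj₂ p) (cbar w)) ds ≈⟨ ds≈gs w ŵ ⟩
          Σ-list (λ p → proj₁ p ⊗ proj₂ p w) gs                   ∎
        (no ¬cp) → begin
          wordCombination as w                                    ≈⟨ wordCombination-vanishes as cps ¬cp ⟩
          0#                                                      ≈⟨ Σ-zero gs (All.map (λ r → 𝕜.trans (*-congˡ (Rel-vanishes r ¬cp)) (zeroʳ _)) rels) ⟨
          Σ-list (λ p → proj₁ p ⊗ proj₂ p w) gs                   ∎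
      where open ≈-Reasoning

theorem3p2 : ∀ {c ℓ : Level} (F : Field c ℓ) (n L : ℕ) (μ : Vec ℕ L) →
  ∣ μ ∣w ≡ n → 1 ≤ n →
  let open Field F
      open Lin F
  in
  (∀ (cm : Chain n L) → IsMaxChain μ cm →
    ∃ λ (as : List (Carrier × ColWord n L)) →
      All (λ p → IsColPerm μ (proj₂ p)) as ×
      InImδ μ (λ c′ → ind _≟C_ cm c′ - cbarImage as c′))
  ×
  (∀ (as : List (Carrier × ColWord n L)) → All (λ p → IsColPerm μ (proj₂ p)) as →
    (InImδ μ (cbarImage as) →
       InRelSpan μ (λ w → Σ-list (λ p → proj₁ p * ind _≟W_ (proj₂ p) w) as))
    ×
    (InRelSpan μ (λ w → Σ-list (λ p → proj₁ p * ind _≟W_ (proj₂ p) w) as) →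
       InImδ μ (cbarImage as)))
theorem3p2 F n L μ ∣μ∣≡n n≥1 = spanning , λ as cps → coboundaries⇒relations as cps , relations⇒coboundaries as cps
  where open LinearAlgebra.TopCohomology F μ ∣μ∣≡n n≥1
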